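{- Let $G\neq P_n$ be a caterpillar tree on $n$ vertices with diameter $D$, remoteness $\rho$ and exactly one centroidal vertex. Suppose $P=v_0v_1\ldots v_D$ is a diametric path in $G$ such that $v_j\in P$ is the unique centroidal vertex of $G$ and each of the vertices $v_{j+1},\ldots,v_D$ has degree at most $2$. Then there is a caterpillar tree $G'$ on $n$ vertices with diameter $D+1$ and remoteness $\rho(G')\leq\rho+\frac12$.
   Context: $P_n$ is the path on $n$ vertices. A caterpillar tree is a tree in which removing all leaves yields a path. $d(u,v)$ is the length of a shortest $u$–$v$ path; the diameter $D$ is the maximum distance between two vertices, and a diametric path is a shortest path between two vertices at distance $D$. The normalized transmission of $v$ is $\pi(v)=\frac{1}{n-1}\sum_u d(v,u)$, the remoteness is $\rho(G)=\max_v\pi(v)$, and a vertex $v$ is centroidal if $\pi(v)=\min_u \pi(u)$. -}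

module Defs where

open import Data.Bool using (Bool; true; false; _∧_; _∨_; not; if_then_else_)
open import Data.Nat as ℕ using (ℕ; zero; suc; _≤_; _<_)
open import Data.Fin using (Fin; zero; suc; toℕ; inject₁; fromℕ; _≟_)
open import Data.List using (List; map; foldr; allFin)
open import Data.Nat.ListAction using (sum)
open import Data.Bool.ListAction using (any)
open import Data.Product using (Σ; ∃; ∃-syntax; _×_; _,_)
open import Data.Sum using (_⊎_)
open import Data.Integer using (+_)
open import Data.Rational as ℚ using (ℚ; 0ℚ)
open import Relation.Nullary using (¬_)
open import Relation.Nullary.Decidable using (⌊_⌋)
open import Relation.Binary.PropositionalEquality using (_≡_)
open import Function.Definitions using (Injective)
open import Function.Bundles using (_⇔_)

record Graph (n : ℕ) : Set where
  field
    adj    : Fin n → Fin n → Bool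
    sym    : ∀ u v → adj u v ≡ adj v u
    irrefl : ∀ u → adj u u ≡ false
open Graph public

module _ {n : ℕ} (G : Graph n) where

  Adj : Fin n → Fin n → Set
  Adj u v = adj G u v ≡ true

  data Walk : Fin n → Fin n → ℕ → Set where
    here : ∀ {u} → Walk u u 0
    step : ∀ {u w v k} → Adj u w → Walk w v k → Walk u v (suc k)

  Connected : Set
  Connected = ∀ u v → ∃[ k ] Walk u v k

  Cycle : Set
  Cycle = ∃[ k ] Σ (Fin (suc (suc (suc k))) → Fin n) λ c →
            Injective _≡_ _≡_ c
          × (∀ (i : Fin (suc (suc k))) → Adj (c (inject₁ i)) (c (suc i)))
          × Adj (c (fromℕ (suc (suc k)))) (c zero)

  Acyclic : Set
  Acyclic = ¬ Cycle

  IsTree : Set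
  IsTree = Connected × Acyclic

  deg : Fin n → ℕ
  deg v = sum (map (λ w → if adj G v w then 1 else 0) (allFin n))

  isLeaf : Fin n → Bool
  isLeaf v = deg v ℕ.≡ᵇ 1

  -- The subgraph induced by the vertex set S is (isomorphic to) a path P_m:
  -- an injective enumeration w of exactly the vertices of S such that
  -- w i and w j are adjacent iff |i - j| = 1.
  InducesPath : (Fin n → Bool) → Set
  InducesPath S = ∃[ m ] Σ (Fin m → Fin n) λ w →
      Injective _≡_ _≡_ w
    × (∀ x → (S x ≡ true) ⇔ (∃[ i ] w i ≡ x))
    × (∀ i j → Adj (w i) (w j) ⇔ (suc (toℕ i) ≡ toℕ j ⊎ suc (toℕ j) ≡ toℕ i))

  IsPathGraph : Set
  IsPathGraph = InducesPath (λ _ → true)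

  IsCaterpillar : Set
  IsCaterpillar = IsTree × InducesPath (λ v → not (isLeaf v))

  reach : ℕ → Fin n → Fin n → Bool
  reach zero    u v = ⌊ u ≟ v ⌋
  reach (suc k) u v = reach k u v ∨ any (λ w → adj G u w ∧ reach k w v) (allFin n)

  leastFrom : ℕ → ℕ → (ℕ → Bool) → ℕ
  leastFrom zero     s p = s
  leastFrom (suc f) s p = if p s then s else leastFrom f (suc s) p

  -- d(u,v): length of a shortest u–v walk (= n if none of length < n exists,
  -- which never happens in a connected graph)
  dist : Fin n → Fin n → ℕ
  dist u v = leastFrom n 0 (λ k → reach k u v)

  maxℕ : List ℕ → ℕ
  maxℕ = foldr ℕ._⊔_ 0

  diam : ℕ
  diam = maxℕ (map (λ u → maxℕ (map (dist u) (allFin n))) (allFin n))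

  transmission : Fin n → ℕ
  transmission v = sum (map (dist v) (allFin n))

-- t / (n - 1); degenerate convention 0 for n ≤ 1 (π undefined there)
normalize : ℕ → ℕ → ℚ
normalize zero          t = 0ℚ
normalize (suc zero)    t = 0ℚ
normalize (suc (suc k)) t = (+ t) ℚ./ suc k

module _ {n : ℕ} (G : Graph n) where

  π : Fin n → ℚ
  π v = normalize n (transmission G v)

  -- remoteness: maximum of π (all π ≥ 0, so folding from 0 is harmless)
  remoteness : ℚ
  remoteness = foldr ℚ._⊔_ 0ℚ (map π (allFin n))

  Centroidal : Fin n → Set
  Centroidal v = ∀ u → π v ℚ.≤ π u

  DiametricPath : (D : ℕ) → (Fin (suc D) → Fin n) → Set
  DiametricPath D v = diam G ≡ D
                    × (∀ (i : Fin D) → Adj G (v (inject₁ i)) (v (suc i)))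
                    × dist G (v zero) (v (fromℕ D)) ≡ D

module Submission where

-- The non-leaves of G form a spine of m ≥ 1 vertices, each end of which carries a leaf (a, b); a, the spine
-- and b form a diametric path, so D = m + 1, and as G is not a path some vertex lies off it, so n ≥ D + 2.
-- Every vertex y off that path has d(a,y) + d(b,y) = D + 2, whence T(a) + T(b) ≥ (D+2)n − 2(D+1) for the
-- transmissions T, and ρ ≥ (T(a) + T(b)) / (2(n−1)).
-- G′ is the path on D + 2 vertices with the remaining n − D − 2 vertices attached alternately to its one or
-- two middle vertices. Summing distances, 2T′(x) + 2D + 3 ≤ (D+3)n for every vertex x of G′, so
-- 2T′(x) ≤ T(a) + T(b) + n − 1, i.e. π′(x) ≤ ρ + ½.

open import Defs hiding (sym)

open import Data.Bool using (Bool; true; false; T; not; _∧_; if_then_else_)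
open import Data.Bool.Properties using (T-≡; T-∨; T-∧)
open import Data.Empty using (⊥-elim)
open import Data.Fin as Fin using (Fin; zero; suc; toℕ; fromℕ<; _≟_; _↑ˡ_; _↑ʳ_)
import Data.Fin.Properties as Finₚ
open import Data.Integer as ℤ using (+≤+)
import Data.Integer.Properties as ℤₚ
open import Data.List using (List; foldr; map; tabulate; allFin)
open import Data.List.Properties using (map-tabulate; foldr-preservesᵇ; foldr-preservesᵒ)
open import Data.List.Relation.Unary.All using (All)
import Data.List.Relation.Unary.All.Properties as All
open import Data.List.Relation.Unary.Any using (Any)
import Data.List.Relation.Unary.Any.Properties as Any
open import Data.Nat as ℕ
  using (ℕ; zero; suc; pred; _+_; _*_; _∸_; _⊔_; _/_; _%_; ∣_-_∣; _≤_; _<_; z≤n; s≤s; s≤s⁻¹; _≤?_; _<?_)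
open import Data.Nat.DivMod using (m≡m%n+[m/n]*n; m%n<n)
import Data.Nat.ListAction as ListAction
open import Data.Nat.Properties hiding (_≟_)
open import Data.Nat.Solver using (module +-*-Solver)
open import Data.Product using (Σ; ∃-syntax; _×_; _,_; proj₁; proj₂)
open import Data.Rational as ℚ using (ℚ; ½; 0ℚ)
import Data.Rational.Properties as ℚₚ
open import Data.Rational.Unnormalised as ℚᵘ using (mkℚᵘ; *≤*)
import Data.Rational.Unnormalised.Properties as ℚᵘₚ
open import Data.Sum using (_⊎_; inj₁; inj₂; [_,_]′)
open import Function using (_∘_)
open import Function.Bundles using (_⇔_; mk⇔; Equivalence)
open import Relation.Nullary using (¬_; Dec; yes; no)
open import Relation.Nullary.Decidable
  using (⌊_⌋; toWitness; fromWitness; ¬?; _×-dec_; _⊎-dec_; dec-false; does-⇔; isYes≗does)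
open import Relation.Binary.PropositionalEquality
  using (_≡_; _≢_; refl; sym; trans; cong; cong₂; subst; subst₂; module ≡-Reasoning)

open Equivalence using (to; from)
open import Algebra.Properties.Semiring.Sum +-*-semiring
  using (sum; sum-syntax; ∑-distrib-+; ∑-comm; sum-cong-≗; sum-init-last; *-distribˡ-sum)
open +-*-Solver using (solve; _:+_; _:*_; _:=_; con)

sum-tabulate : ∀ {n} (f : Fin n → ℕ) → ListAction.sum (tabulate f) ≡ sum f
sum-tabulate {zero}  f = refl
sum-tabulate {suc n} f = cong (f zero +_) (sum-tabulate (f ∘ suc))

sum-allFin : ∀ {n} (f : Fin n → ℕ) → ListAction.sum (map f (allFin n)) ≡ sum f
sum-allFin f = trans (cong ListAction.sum (map-tabulate (λ i → i) f)) (sum-tabulate f)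

∑-mono-≤ : ∀ {n} {f g : Fin n → ℕ} → (∀ i → f i ≤ g i) → sum f ≤ sum g
∑-mono-≤ {zero}  f≤g = z≤n
∑-mono-≤ {suc n} f≤g = +-mono-≤ (f≤g zero) (∑-mono-≤ (f≤g ∘ suc))

∑-const : ∀ n c → ∑[ i < n ] c ≡ n * c
∑-const zero    c = refl
∑-const (suc n) c = cong (c +_) (∑-const n c)

∑-++ : ∀ m {n} (f : Fin (m + n) → ℕ) → sum f ≡ ∑[ i < m ] f (i ↑ˡ n) + ∑[ j < n ] f (m ↑ʳ j)
∑-++ zero    f = refl
∑-++ (suc m) f = trans (cong (f zero +_) (∑-++ m (f ∘ suc))) (sym (+-assoc (f zero) _ _))

∑-mono-≤-+ : ∀ {n} {f g : Fin n → ℕ} {k} x → (∀ y → x ≢ y → f y ≤ g y) → f x + k ≤ g x →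
             sum f + k ≤ sum g
∑-mono-≤-+ {f = f} {g} {k} zero f≤g fx+k≤gx = begin
  f zero + sum (f ∘ suc) + k ≡⟨ +-assoc (f zero) _ k ⟩
  f zero + (sum (f ∘ suc) + k) ≡⟨ cong (f zero +_) (+-comm _ k) ⟩
  f zero + (k + sum (f ∘ suc)) ≡⟨ +-assoc (f zero) k _ ⟨
  f zero + k + sum (f ∘ suc)   ≤⟨ +-mono-≤ fx+k≤gx (∑-mono-≤ (λ y → f≤g (suc y) (λ ()))) ⟩
  g zero + sum (g ∘ suc)       ∎
  where open ≤-Reasoning
∑-mono-≤-+ {f = f} {g} {k} (suc x) f≤g fx+k≤gx = begin
  f zero + sum (f ∘ suc) + k   ≡⟨ +-assoc (f zero) _ k ⟩
  f zero + (sum (f ∘ suc) + k) ≤⟨ +-mono-≤ (f≤g zero (λ ())) (∑-mono-≤-+ x (λ y x≢y → f≤g (suc y) (x≢y ∘ Finₚ.suc-injective)) fx+k≤gx) ⟩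
  g zero + sum (g ∘ suc)       ∎
  where open ≤-Reasoning

count : ∀ {n} → (Fin n → Bool) → ℕ
count {n} p = ∑[ i < n ] (if p i then 1 else 0)

count-≡0 : ∀ {n} (p : Fin n → Bool) → (∀ i → p i ≡ false) → count p ≡ 0
count-≡0 {zero}  p none = refl
count-≡0 {suc n} p none rewrite none zero = count-≡0 (p ∘ suc) (none ∘ suc)

count-≥1 : ∀ {n} (p : Fin n → Bool) {i} → p i ≡ true → 1 ≤ count p
count-≥1 p {zero}  pi rewrite pi = s≤s z≤n
count-≥1 p {suc i} pi = ≤-trans (count-≥1 (p ∘ suc) pi) (m≤n+m _ _)

count-≥2 : ∀ {n} (p : Fin n → Bool) {i j} → p i ≡ true → p j ≡ true → i ≢ j → 2 ≤ count p
count-≥2 p {zero}  {zero}  pi pj i≢j = ⊥-elim (i≢j refl)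
count-≥2 p {zero}  {suc j} pi pj i≢j rewrite pi = s≤s (count-≥1 (p ∘ suc) pj)
count-≥2 p {suc i} {zero}  pi pj i≢j rewrite pj = s≤s (count-≥1 (p ∘ suc) pi)
count-≥2 p {suc i} {suc j} pi pj i≢j =
  ≤-trans (count-≥2 (p ∘ suc) pi pj (i≢j ∘ cong Fin.suc)) (m≤n+m _ _)

count-≡1 : ∀ {n} (p : Fin n → Bool) {i} → p i ≡ true → (∀ j → p j ≡ true → j ≡ i) → count p ≡ 1
count-≡1 p {zero} pi unique rewrite pi = cong suc (count-≡0 (p ∘ suc) rest)
  where
  rest : ∀ j → p (suc j) ≡ false
  rest j with p (suc j) in pj
  ... | false = refl
  ... | true with () ← unique (suc j) pj
count-≡1 p {suc i} pi unique with p zero in p0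
... | true with () ← unique zero p0
... | false = count-≡1 (p ∘ suc) pi (λ j pj → Finₚ.suc-injective (unique (suc j) pj))

count-witness : ∀ {n} (p : Fin n → Bool) → 1 ≤ count p → ∃[ i ] p i ≡ true
count-witness {suc n} p c≥1 with p zero in p0
... | true  = zero , p0
... | false with i , pi ← count-witness (p ∘ suc) c≥1 = suc i , pi

module _ {A : Set} {P : A → Set} where

  All-map-allFin : ∀ {n} (f : Fin n → A) → (∀ i → P (f i)) → All P (map f (allFin n))
  All-map-allFin f Pf = subst (All P) (sym (map-tabulate (λ i → i) f)) (All.tabulate⁺ Pf)

  Any-map-allFin : ∀ {n} (f : Fin n → A) i → P (f i) → Any P (map f (allFin n))
  Any-map-allFin f i Pfi = subst (Any P) (sym (map-tabulate (λ i → i) f)) (Any.tabulate⁺ i Pfi)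

⊔-fold-≤ : ∀ {B} (xs : List ℕ) → All (_≤ B) xs → foldr _⊔_ 0 xs ≤ B
⊔-fold-≤ xs = foldr-preservesᵇ ⊔-lub z≤n

≤-⊔-fold : ∀ {x} (xs : List ℕ) → Any (x ≤_) xs → x ≤ foldr _⊔_ 0 xs
≤-⊔-fold xs = foldr-preservesᵒ (λ a b → [ (λ x≤a → ≤-trans x≤a (m≤m⊔n a b)) , (λ x≤b → ≤-trans x≤b (m≤n⊔m a b)) ]′) 0 xs ∘ inj₂

leastFrom-≤ : ∀ {n} (G : Graph n) fuel s p {t} → T (p t) → s ≤ t → leastFrom G fuel s p ≤ t
leastFrom-≤ G zero       s p pt s≤t = s≤t
leastFrom-≤ G (suc fuel) s p pt s≤t with p s in ps
... | true = s≤t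
... | false with m≤n⇒m<n∨m≡n s≤t
...   | inj₁ s<t  = leastFrom-≤ G fuel (suc s) p pt s<t
...   | inj₂ refl = ⊥-elim (subst T ps pt)

≤-leastFrom : ∀ {n} (G : Graph n) fuel s p {t} → (∀ {r} → s ≤ r → r < t → ¬ T (p r)) →
              t ≤ s + fuel → t ≤ leastFrom G fuel s p
≤-leastFrom G zero       s p below t≤s = subst (_ ≤_) (+-identityʳ s) t≤s
≤-leastFrom G (suc fuel) s p {t} below t≤s+f with p s in ps
... | false = ≤-leastFrom G fuel (suc s) p (below ∘ <⇒≤) (subst (t ≤_) (+-suc s fuel) t≤s+f)
... | true with t ≤? s
...   | yes t≤s = t≤s
...   | no  t≰s = ⊥-elim (below ≤-refl (≰⇒> t≰s) (subst T (sym ps) _))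

module _ {n : ℕ} (G : Graph n) where

  Adj-sym : ∀ {u v} → Adj G u v → Adj G v u
  Adj-sym {u} {v} uv = trans (Graph.sym G v u) uv

  Adj-irrefl : ∀ {u} → ¬ Adj G u u
  Adj-irrefl {u} uu with () ← trans (sym uu) (Graph.irrefl G u)

  Adj⇒≢ : ∀ {u v} → Adj G u v → u ≢ v
  Adj⇒≢ uv refl = Adj-irrefl uv

  _++ʷ_ : ∀ {u w v k l} → Walk G u w k → Walk G w v l → Walk G u v (k + l)
  here       ++ʷ q = q
  step uw p ++ʷ q = step uw (p ++ʷ q)

  reverseʷ : ∀ {u v k} → Walk G u v k → Walk G v u k
  reverseʷ here = here
  reverseʷ {k = suc k} (step uw p) =
    subst (Walk G _ _) (+-comm k 1) (reverseʷ p ++ʷ step (Adj-sym uw) here)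

  walk⇒reach : ∀ {u v k} → Walk G u v k → T (reach G k u v)
  walk⇒reach here = fromWitness refl
  walk⇒reach {u} {v} {suc k} (step {w = w} uw p) = from T-∨ (inj₂ (Any.any⁺ _
    (Any.tabulate⁺ w (from T-∧ (from T-≡ uw , walk⇒reach p)))))

  reach⇒walk : ∀ k {u v} → T (reach G k u v) → ∃[ l ] l ≤ k × Walk G u v l
  reach⇒walk zero r with refl ← toWitness r = 0 , z≤n , here
  reach⇒walk (suc k) {u} {v} r with to T-∨ r
  ... | inj₁ r′ with l , l≤k , p ← reach⇒walk k r′ = l , m≤n⇒m≤1+n l≤k , p
  ... | inj₂ some = step-via (Any.tabulate⁻ (Any.any⁻ _ _ some))
    where
    step-via : ∃[ w ] T (adj G u w ∧ reach G k w v) → ∃[ l ] l ≤ suc k × Walk G u v l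
    step-via (w , uwr) =
      let uw , wr = to T-∧ uwr
          l , l≤k , p = reach⇒walk k wr
      in suc l , s≤s l≤k , step (to T-≡ uw) p

  dist-≤ : ∀ {u v k} → Walk G u v k → dist G u v ≤ k
  dist-≤ p = leastFrom-≤ G n 0 _ (walk⇒reach p) z≤n

  ≤-dist : ∀ {u v} t → (∀ {l} → Walk G u v l → t ≤ l) → t ≤ n → t ≤ dist G u v
  ≤-dist t short t≤n = ≤-leastFrom G n 0 _ no-short-walk t≤n
    where
    no-short-walk : ∀ {r} → 0 ≤ r → r < t → ¬ T (reach G r _ _)
    no-short-walk _ r<t rr with l , l≤r , p ← reach⇒walk _ rr = <⇒≱ r<t (≤-trans (short p) l≤r)

  dist-≤-diam : ∀ u v → dist G u v ≤ diam G
  dist-≤-diam u v = ≤-⊔-fold _ (Any-map-allFin _ u (≤-⊔-fold _ (Any-map-allFin _ v ≤-refl)))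

  diam-≤ : ∀ {B} → (∀ u v → dist G u v ≤ B) → diam G ≤ B
  diam-≤ bound = ⊔-fold-≤ _ (All-map-allFin _ (λ u → ⊔-fold-≤ _ (All-map-allFin _ (bound u))))

  transmission-∑ : ∀ v → transmission G v ≡ sum (dist G v)
  transmission-∑ v = sum-allFin (dist G v)

  deg-count : ∀ v → deg G v ≡ count (adj G v)
  deg-count v = sum-allFin (λ w → if adj G v w then 1 else 0)

  deg≡1⇒isLeaf : ∀ {v} → deg G v ≡ 1 → isLeaf G v ≡ true
  deg≡1⇒isLeaf d≡1 rewrite d≡1 = refl

  2≤deg⇒¬isLeaf : ∀ {v} → 2 ≤ deg G v → isLeaf G v ≡ false
  2≤deg⇒¬isLeaf {v} 2≤d with deg G v
  2≤deg⇒¬isLeaf (s≤s (s≤s _)) | suc (suc _) = refl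

  isLeaf⇒deg≡1 : ∀ {v} → isLeaf G v ≡ true → deg G v ≡ 1
  isLeaf⇒deg≡1 {v} leaf = ≡ᵇ⇒≡ (deg G v) 1 (subst T (sym leaf) _)

∣n-1+n∣≡1 : ∀ n → ∣ n - suc n ∣ ≡ 1
∣n-1+n∣≡1 zero    = refl
∣n-1+n∣≡1 (suc n) = ∣n-1+n∣≡1 n

∣1+n-n∣≡1 : ∀ n → ∣ suc n - n ∣ ≡ 1
∣1+n-n∣≡1 n = trans (∣-∣-comm (suc n) n) (∣n-1+n∣≡1 n)

Consecutive : ℕ → ℕ → Set
Consecutive i j = suc i ≡ j ⊎ suc j ≡ i

Consecutive⇒∣-∣≡1 : ∀ {i j} → Consecutive i j → ∣ i - j ∣ ≡ 1
Consecutive⇒∣-∣≡1 {i} (inj₁ refl) = ∣n-1+n∣≡1 i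
Consecutive⇒∣-∣≡1 {j = j} (inj₂ refl) = ∣1+n-n∣≡1 j

∣-∣≡1⇒Consecutive : ∀ i j → ∣ i - j ∣ ≡ 1 → Consecutive i j
∣-∣≡1⇒Consecutive zero          (suc zero) _ = inj₁ refl
∣-∣≡1⇒Consecutive (suc zero)    zero       _ = inj₂ refl
∣-∣≡1⇒Consecutive (suc i)       (suc j)    e with ∣-∣≡1⇒Consecutive i j e
... | inj₁ i+1≡j = inj₁ (cong suc i+1≡j)
... | inj₂ j+1≡i = inj₂ (cong suc j+1≡i)

∣1+m-n∣≡1+∣m-n∣ : ∀ {m n} → n ≤ m → ∣ suc m - n ∣ ≡ suc ∣ m - n ∣
∣1+m-n∣≡1+∣m-n∣ {m} z≤n = cong suc (sym (∣-∣-identityʳ m))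
∣1+m-n∣≡1+∣m-n∣ (s≤s n≤m) = ∣1+m-n∣≡1+∣m-n∣ n≤m

∣-∣≤ : ∀ {a b c} → a ≤ b + c → b ≤ a + c → ∣ a - b ∣ ≤ c
∣-∣≤ {zero}  {b}     _ b≤  = b≤
∣-∣≤ {suc a} {zero}  a≤ _  = a≤
∣-∣≤ {suc a} {suc b} a≤ b≤ = ∣-∣≤ (s≤s⁻¹ a≤) (s≤s⁻¹ b≤)

module _ {n : ℕ} (G : Graph n) where

  PendantAt : Fin n → Fin n → Set
  PendantAt x y = Adj G x y × (∀ z → Adj G x z → z ≡ y)

  Located : ∀ {m} → (Fin m → Fin n) → Fin n → Set
  Located {m} spine x = (∃[ i ] spine i ≡ x) ⊎ (Σ (Fin m) λ i → PendantAt x (spine i) × (∀ j → spine j ≢ x))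

  record Caterpillar : Set where
    field
      m : ℕ
      spine : Fin m → Fin n
      spine-injective : ∀ {i j} → spine i ≡ spine j → i ≡ j
      spine-adj : ∀ i j → suc (toℕ i) ≡ toℕ j → Adj G (spine i) (spine j)
      spine-adj⁻ : ∀ i j → Adj G (spine i) (spine j) → Consecutive (toℕ i) (toℕ j)
      locate : ∀ x → Located spine x

argmax : ∀ {k} (f : Fin (suc k) → ℕ) → Σ (Fin (suc k)) λ i → ∀ j → f j ≤ f i
argmax {zero}  f = zero , λ { zero → ≤-refl }
argmax {suc k} f with i , max ← argmax (f ∘ suc) | f zero ≤? f (suc i)
... | yes f0≤ = suc i , λ { zero → f0≤ ; (suc j) → max j }
... | no  f0≰ = zero , λ { zero → ≤-refl ; (suc j) → ≤-trans (max j) (<⇒≤ (≰⇒> f0≰)) }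

module _ {n : ℕ} (G : Graph n) {k : ℕ} (c : Fin (suc (suc (suc k))) → Fin n)
         (path : ∀ (i : Fin (suc (suc k))) → Adj G (c (Fin.inject₁ i)) (c (suc i)))
         (close : Adj G (c (Fin.fromℕ (suc (suc k)))) (c zero)) where

  cycle-neighbours : ∀ i → Σ (Fin (suc (suc (suc k)))) λ j → Σ (Fin (suc (suc (suc k)))) λ j′ →
                     j ≢ j′ × Adj G (c i) (c j) × Adj G (c i) (c j′)
  cycle-neighbours zero = suc zero , Fin.fromℕ (suc (suc k)) , (λ ()) , path zero , Adj-sym G close
  cycle-neighbours (suc i) with suc k ℕ.≟ toℕ i
  ... | yes last = Fin.inject₁ i , zero , inject₁-i≢0 , Adj-sym G (path i) ,
                   subst (λ v → Adj G (c v) (c zero)) (sym i-is-last) close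
    where
    i-is-last : suc i ≡ Fin.fromℕ (suc (suc k))
    i-is-last = Finₚ.toℕ-injective (trans (cong suc (sym last)) (sym (Finₚ.toℕ-fromℕ (suc (suc k)))))
    inject₁-i≢0 : Fin.inject₁ i ≢ zero
    inject₁-i≢0 e with () ← trans last (trans (sym (Finₚ.toℕ-inject₁ i)) (cong toℕ e))
  ... | no not-last = Fin.inject₁ i , suc (suc i′) , pred≢succ , Adj-sym G (path i) ,
                      subst (λ v → Adj G (c v) (c (suc (suc i′)))) inject₁-suc-i′ (path (suc i′))
    where
    i′ = Fin.lower₁ i not-last
    inject₁-suc-i′ : Fin.inject₁ (suc i′) ≡ suc i
    inject₁-suc-i′ = cong suc (Finₚ.inject₁-lower₁ i not-last)
    pred≢succ : Fin.inject₁ i ≢ suc (suc i′)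
    pred≢succ e = <⇒≢ (m<n⇒m<1+n (n<1+n (toℕ i))) (trans (sym (Finₚ.toℕ-inject₁ i))
                    (trans (cong toℕ e) (cong (λ v → suc (suc v)) (Finₚ.toℕ-lower₁ i not-last))))

module CaterpillarMetric {n : ℕ} {G : Graph n} (C : Caterpillar G) where
  open Caterpillar C

  Location : Fin n → Set
  Location = Located G spine

  anchorOf : ∀ {x} → Location x → Fin m
  anchorOf (inj₁ (i , _))     = i
  anchorOf (inj₂ (i , _ , _)) = i

  heightOf : ∀ {x} → Location x → ℕ
  heightOf (inj₁ _) = 0
  heightOf (inj₂ _) = 1

  anchor : Fin n → Fin m
  anchor x = anchorOf (locate x)

  pos : Fin n → ℕ
  pos x = toℕ (anchor x)

  height : Fin n → ℕ
  height x = heightOf (locate x)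

  data Placement (x : Fin n) (i : Fin m) (h : ℕ) : Set where
    on-spine : spine i ≡ x → h ≡ 0 → Placement x i h
    pendant  : PendantAt G x (spine i) → (∀ j → spine j ≢ x) → h ≡ 1 → Placement x i h

  placementOf : ∀ {x} (l : Location x) → Placement x (anchorOf l) (heightOf l)
  placementOf (inj₁ (i , e))          = on-spine e refl
  placementOf (inj₂ (i , xi , off)) = pendant xi off refl

  placement : ∀ x → Placement x (anchor x) (height x)
  placement x = placementOf (locate x)

  height≤1 : ∀ x → height x ≤ 1
  height≤1 x with placement x
  ... | on-spine _ h≡0  = ≤-trans (≤-reflexive h≡0) z≤n
  ... | pendant _ _ h≡1 = ≤-reflexive h≡1

  locate-spine : ∀ i → anchor (spine i) ≡ i × height (spine i) ≡ 0
  locate-spine i with placement (spine i)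
  ... | on-spine e h≡0    = spine-injective e , h≡0
  ... | pendant _ off _ = ⊥-elim (off i refl)

  data EdgeShape (x z : Fin n) : Set where
    along-spine : height x ≡ 0 → height z ≡ 0 → Consecutive (pos x) (pos z) → EdgeShape x z
    leg         : pos x ≡ pos z → height x + height z ≡ 1 → EdgeShape x z

  edgeShape : ∀ {x z} → Adj G x z → EdgeShape x z
  edgeShape {x} {z} xz with placement x | placement z
  ... | on-spine ex hx | on-spine ez hz =
    along-spine hx hz (spine-adj⁻ _ _ (subst₂ (Adj G) (sym ex) (sym ez) xz))
  ... | on-spine ex hx | pendant (_ , only) _ hz =
    leg (cong toℕ (spine-injective (trans ex (only x (Adj-sym G xz))))) (cong₂ _+_ hx hz)
  ... | pendant (_ , only) _ hx | on-spine ez hz =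
    leg (cong toℕ (spine-injective (sym (trans ez (only z xz))))) (cong₂ _+_ hx hz)
  ... | pendant (_ , only) _ _ | pendant _ off _ = ⊥-elim (off (anchor x) (sym (only z xz)))

  δ : Fin n → Fin n → ℕ
  δ x y with x ≟ y
  ... | yes _ = 0
  ... | no  _ = height x + ∣ pos x - pos y ∣ + height y

  δ-refl : ∀ x → δ x x ≡ 0
  δ-refl x with x ≟ x
  ... | yes _  = refl
  ... | no x≢x = ⊥-elim (x≢x refl)

  δ-≢ : ∀ {x y} → x ≢ y → δ x y ≡ height x + ∣ pos x - pos y ∣ + height y
  δ-≢ {x} {y} x≢y with x ≟ y
  ... | yes x≡y = ⊥-elim (x≢y x≡y)
  ... | no  _   = refl

  δ-≤ : ∀ x y → δ x y ≤ height x + ∣ pos x - pos y ∣ + height y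
  δ-≤ x y with x ≟ y
  ... | yes _ = z≤n
  ... | no  _ = ≤-refl

  edge-length : ∀ {x z} → Adj G x z → height x + ∣ pos x - pos z ∣ + height z ≡ 1
  edge-length {x} {z} xz with edgeShape xz
  ... | along-spine hx hz c rewrite hx | hz = trans (+-identityʳ _) (Consecutive⇒∣-∣≡1 c)
  ... | leg e hs rewrite e | ∣n-n∣≡0 (pos z) = trans (cong (_+ height z) (+-identityʳ (height x))) hs

  edge-step : ∀ {x z} → Adj G x z → ∀ p → height x + ∣ pos x - p ∣ ≤ 1 + (height z + ∣ pos z - p ∣)
  edge-step {x} {z} xz p with edgeShape xz
  ... | along-spine hx hz c rewrite hx | hz = begin
    ∣ pos x - p ∣                     ≤⟨ ∣-∣-triangle (pos x) (pos z) p ⟩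
    ∣ pos x - pos z ∣ + ∣ pos z - p ∣ ≡⟨ cong (_+ ∣ pos z - p ∣) (Consecutive⇒∣-∣≡1 c) ⟩
    1 + ∣ pos z - p ∣                 ∎
    where open ≤-Reasoning
  ... | leg e _ rewrite e = begin
    height x + ∣ pos z - p ∣       ≤⟨ +-monoˡ-≤ _ (≤-trans (height≤1 x) (s≤s z≤n)) ⟩
    1 + height z + ∣ pos z - p ∣   ≡⟨ +-assoc 1 (height z) _ ⟩
    1 + (height z + ∣ pos z - p ∣) ∎
    where open ≤-Reasoning

  δ-≤-walk : ∀ {x y k} → Walk G x y k → δ x y ≤ k
  δ-≤-walk {x} here = ≤-reflexive (δ-refl x)
  δ-≤-walk {x} {y} (step {w = z} xz p) with z ≟ y
  ... | yes refl = ≤-trans (δ-≤ x z) (≤-trans (≤-reflexive (edge-length xz)) (s≤s z≤n))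
  ... | no z≢y = begin
    δ x y                                                 ≤⟨ δ-≤ x y ⟩
    height x + ∣ pos x - pos y ∣ + height y               ≤⟨ +-monoˡ-≤ (height y) (edge-step xz (pos y)) ⟩
    1 + (height z + ∣ pos z - pos y ∣) + height y         ≡⟨ +-assoc 1 _ (height y) ⟩
    1 + (height z + ∣ pos z - pos y ∣ + height y)         ≡⟨ cong suc (δ-≢ z≢y) ⟨
    1 + δ z y                                             ≤⟨ s≤s (δ-≤-walk p) ⟩
    _                                                     ∎
    where open ≤-Reasoning

  spine-walk-up : ∀ d i j → toℕ i + d ≡ toℕ j → Walk G (spine i) (spine j) d
  spine-walk-up zero i j i+0≡j =
    subst (λ k → Walk G (spine i) (spine k) 0) (Finₚ.toℕ-injective (trans (sym (+-identityʳ _)) i+0≡j)) here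
  spine-walk-up (suc d) i j i+1+d≡j = step (spine-adj i i′ (sym toℕ-i′)) (spine-walk-up d i′ j i′+d≡j)
    where
    i+1<m : suc (toℕ i) < m
    i+1<m = ≤-<-trans (subst (suc (toℕ i) ≤_) (sym (+-suc (toℕ i) d)) (s≤s (m≤m+n _ d)))
                      (subst (_< m) (sym i+1+d≡j) (Finₚ.toℕ<n j))
    i′ : Fin m
    i′ = fromℕ< i+1<m
    toℕ-i′ : toℕ i′ ≡ suc (toℕ i)
    toℕ-i′ = Finₚ.toℕ-fromℕ< i+1<m
    i′+d≡j : toℕ i′ + d ≡ toℕ j
    i′+d≡j = trans (cong (_+ d) toℕ-i′) (trans (sym (+-suc (toℕ i) d)) i+1+d≡j)

  spine-walk : ∀ i j → Walk G (spine i) (spine j) ∣ toℕ i - toℕ j ∣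
  spine-walk i j with ≤-total (toℕ i) (toℕ j)
  ... | inj₁ i≤j = subst (Walk G _ _) (sym (m≤n⇒∣m-n∣≡n∸m i≤j)) (spine-walk-up _ i j (m+[n∸m]≡n i≤j))
  ... | inj₂ j≤i = subst (Walk G _ _) (sym (m≤n⇒∣n-m∣≡n∸m j≤i)) (reverseʷ G (spine-walk-up _ j i (m+[n∸m]≡n j≤i)))

  leg-walk : ∀ x → Walk G x (spine (anchor x)) (height x)
  leg-walk x with height x | placement x
  ... | _ | on-spine e h≡0 rewrite h≡0 = subst (λ v → Walk G v (spine (anchor x)) 0) e here
  ... | _ | pendant (xa , _) _ h≡1 rewrite h≡1 = step xa here

  δ-walk : ∀ x y → Walk G x y (δ x y)
  δ-walk x y with x ≟ y
  ... | yes refl = here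
  ... | no _ = subst (Walk G x y) (sym (+-assoc (height x) _ (height y)))
                 (_++ʷ_ G (leg-walk x) (_++ʷ_ G (spine-walk (anchor x) (anchor y)) (reverseʷ G (leg-walk y))))

  δ-≤-1+m : ∀ x y → δ x y ≤ suc m
  δ-≤-1+m x y = begin
    δ x y                                   ≤⟨ δ-≤ x y ⟩
    height x + ∣ pos x - pos y ∣ + height y ≤⟨ +-mono-≤ (+-monoˡ-≤ _ (height≤1 x)) (height≤1 y) ⟩
    1 + ∣ pos x - pos y ∣ + 1               ≡⟨ +-comm (suc ∣ pos x - pos y ∣) 1 ⟩
    suc (suc ∣ pos x - pos y ∣)             ≤⟨ s≤s (≤-trans (s≤s (∣m-n∣≤m⊔n (pos x) (pos y))) (⊔-lub (Finₚ.toℕ<n (anchor x)) (Finₚ.toℕ<n (anchor y)))) ⟩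
    suc m                                   ∎
    where open ≤-Reasoning

  dist≡δ : suc m ≤ n → ∀ x y → dist G x y ≡ δ x y
  dist≡δ 1+m≤n x y = ≤-antisym (dist-≤ G (δ-walk x y)) (≤-dist G (δ x y) δ-≤-walk (≤-trans (δ-≤-1+m x y) 1+m≤n))

  δ-sym : ∀ x y → δ x y ≡ δ y x
  δ-sym x y with x ≟ y
  ... | yes refl = sym (δ-refl x)
  ... | no x≢y = begin
    height x + ∣ pos x - pos y ∣ + height y ≡⟨ +-comm (height x + _) (height y) ⟩
    height y + (height x + ∣ pos x - pos y ∣) ≡⟨ cong (height y +_) (+-comm (height x) _) ⟩
    height y + (∣ pos x - pos y ∣ + height x) ≡⟨ +-assoc (height y) _ (height x) ⟨
    height y + ∣ pos x - pos y ∣ + height x ≡⟨ cong (λ d → height y + d + height x) (∣-∣-comm (pos x) (pos y)) ⟩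
    height y + ∣ pos y - pos x ∣ + height x ≡⟨ δ-≢ (x≢y ∘ sym) ⟨
    δ y x                                   ∎
    where open ≡-Reasoning

  Adj⇒δ≡1 : ∀ {x y} → Adj G x y → δ x y ≡ 1
  Adj⇒δ≡1 xy = trans (δ-≢ (Adj⇒≢ G xy)) (edge-length xy)

  δ≡1⇒Adj : ∀ {x y} → δ x y ≡ 1 → Adj G x y
  δ≡1⇒Adj {x} {y} δ≡1 with subst (Walk G x y) δ≡1 (δ-walk x y)
  ... | step xy here = xy

  -- A vertex of a cycle has two neighbours on it, so is not pendant; the cycle vertex furthest along the
  -- spine then has both its cycle neighbours at the spine vertex before it, so they coincide.
  acyclic : Acyclic G
  acyclic (k , c , c-injective , path , close) =
    j≢j′ (c-injective (trans (sym (on-spine-at j)) (trans (cong spine same-anchor) (on-spine-at j′))))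
    where
    on-cycle-on-spine : ∀ i → spine (anchor (c i)) ≡ c i × height (c i) ≡ 0
    on-cycle-on-spine i with placement (c i) | cycle-neighbours G c path close i
    ... | on-spine e h≡0 | _ = e , h≡0
    ... | pendant (_ , only) _ _ | j , j′ , j≢j′ , ij , ij′ =
      ⊥-elim (j≢j′ (c-injective (trans (only _ ij) (sym (only _ ij′)))))
    on-spine-at : ∀ i → spine (anchor (c i)) ≡ c i
    on-spine-at i = proj₁ (on-cycle-on-spine i)
    top = argmax (λ i → pos (c i))
    t = proj₁ top
    below-top : ∀ j → Adj G (c t) (c j) → suc (pos (c j)) ≡ pos (c t)
    below-top j tj with edgeShape tj
    ... | along-spine _ _ (inj₁ up)   = ⊥-elim (<⇒≱ (≤-reflexive up) (proj₂ top j))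
    ... | along-spine _ _ (inj₂ down) = down
    ... | leg _ hs with () ← trans (sym hs) (cong₂ _+_ (proj₂ (on-cycle-on-spine t)) (proj₂ (on-cycle-on-spine j)))
    neighbours = cycle-neighbours G c path close t
    j = proj₁ neighbours
    j′ = proj₁ (proj₂ neighbours)
    j≢j′ = proj₁ (proj₂ (proj₂ neighbours))
    tj = proj₁ (proj₂ (proj₂ (proj₂ neighbours)))
    tj′ = proj₂ (proj₂ (proj₂ (proj₂ neighbours)))
    same-anchor : anchor (c j) ≡ anchor (c j′)
    same-anchor = Finₚ.toℕ-injective (suc-injective (trans (below-top j tj) (sym (below-top j′ tj′))))

module _ {n : ℕ} {G : Graph n} where

  PendantAt⇒deg≡1 : ∀ {x y} → PendantAt G x y → deg G x ≡ 1
  PendantAt⇒deg≡1 (xy , only) = trans (deg-count G _) (count-≡1 _ xy only)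

  caterpillar⇒IsCaterpillar : (C : Caterpillar G) → (∀ i → 2 ≤ deg G (Caterpillar.spine C i)) → IsCaterpillar G
  caterpillar⇒IsCaterpillar C spine-deg =
    ((λ u v → δ u v , δ-walk u v) , acyclic) , m , spine , spine-injective ,
    (λ x → mk⇔ (nonleaf⇒spine x) (spine⇒nonleaf x)) , (λ i j → mk⇔ (spine-adj⁻ i j) (spine-adj⇐ i j))
    where
    open Caterpillar C
    open CaterpillarMetric C
    nonleaf⇒spine : ∀ x → not (isLeaf G x) ≡ true → ∃[ i ] spine i ≡ x
    nonleaf⇒spine x nonleaf with placement x
    ... | on-spine e _ = anchor x , e
    ... | pendant p _ _ with () ← trans (sym nonleaf) (cong not (deg≡1⇒isLeaf G (PendantAt⇒deg≡1 p)))
    spine⇒nonleaf : ∀ x → ∃[ i ] spine i ≡ x → not (isLeaf G x) ≡ true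
    spine⇒nonleaf x (i , refl) = cong not (2≤deg⇒¬isLeaf G (spine-deg i))
    spine-adj⇐ : ∀ i j → Consecutive (toℕ i) (toℕ j) → Adj G (spine i) (spine j)
    spine-adj⇐ i j (inj₁ i+1≡j) = spine-adj i j i+1≡j
    spine-adj⇐ i j (inj₂ j+1≡i) = Adj-sym G (spine-adj j i j+1≡i)

module _ {n : ℕ} {G : Graph n} (C : Caterpillar G) where
  open Caterpillar C
  open CaterpillarMetric C

  record Ends : Set where
    field
      a b      : Fin n
      a≢b      : a ≢ b
      height-a : height a ≡ 1
      height-b : height b ≡ 1
      pos-a    : pos a ≡ 0
      pos-b    : suc (pos b) ≡ m

-- Extending the spine by its two end vertices a and b gives a path a, spine 0, …, spine (m-1), b;
-- pathPos is the place on that path of (the foot of) a vertex and offPath whether it hangs off it.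
module LongPath {n : ℕ} {G : Graph n} {C : Caterpillar G} (E : Ends C) where
  open Caterpillar C
  open CaterpillarMetric C
  open Ends E

  data EndView (x : Fin n) : Set where
    is-a  : x ≡ a → EndView x
    is-b  : x ≡ b → EndView x
    inner : x ≢ a → x ≢ b → EndView x

  endView : ∀ x → EndView x
  endView x with x ≟ a | x ≟ b
  ... | yes x≡a | _       = is-a x≡a
  ... | no  _   | yes x≡b = is-b x≡b
  ... | no  x≢a | no  x≢b = inner x≢a x≢b

  pathPosOf : ∀ {x} → EndView x → ℕ
  pathPosOf (is-a _)    = 0
  pathPosOf (is-b _)    = suc m
  pathPosOf {x} (inner _ _) = suc (pos x)

  offPathOf : ∀ {x} → EndView x → ℕ
  offPathOf (is-a _)        = 0
  offPathOf (is-b _)        = 0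
  offPathOf {x} (inner _ _) = height x

  pathPos offPath : Fin n → ℕ
  pathPos x = pathPosOf (endView x)
  offPath x = offPathOf (endView x)

  private
    Formula : ∀ {x y} → EndView x → EndView y → Set
    Formula {x} {y} vx vy = δ x y ≡ ∣ pathPosOf vx - pathPosOf vy ∣ + offPathOf vx + offPathOf vy

    flip : ∀ {x y} (vx : EndView x) (vy : EndView y) → Formula vy vx → Formula vx vy
    flip {x} {y} vx vy f = begin
      δ x y                  ≡⟨ δ-sym x y ⟩
      δ y x                  ≡⟨ f ⟩
      ∣ py - px ∣ + oy + ox ≡⟨ cong (λ d → d + oy + ox) (∣-∣-comm py px) ⟩
      ∣ px - py ∣ + oy + ox ≡⟨ +-assoc ∣ px - py ∣ oy ox ⟩
      ∣ px - py ∣ + (oy + ox) ≡⟨ cong (∣ px - py ∣ +_) (+-comm oy ox) ⟩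
      ∣ px - py ∣ + (ox + oy) ≡⟨ +-assoc ∣ px - py ∣ ox oy ⟨
      ∣ px - py ∣ + ox + oy ∎
      where
      open ≡-Reasoning
      px = pathPosOf vx
      py = pathPosOf vy
      ox = offPathOf vx
      oy = offPathOf vy

    a-to-b : δ a b ≡ suc m + 0 + 0
    a-to-b = begin
      δ a b                                    ≡⟨ δ-≢ a≢b ⟩
      height a + ∣ pos a - pos b ∣ + height b ≡⟨ cong₂ (λ h d → h + d + height b) height-a (cong (∣_- pos b ∣) pos-a) ⟩
      1 + pos b + height b                     ≡⟨ cong (λ h → 1 + pos b + h) height-b ⟩
      suc (pos b + 1)                          ≡⟨ cong suc (+-comm (pos b) 1) ⟩
      suc (suc (pos b))                        ≡⟨ cong suc pos-b ⟩
      suc m                                    ≡⟨ +-identityʳ _ ⟨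
      suc m + 0                                ≡⟨ +-identityʳ _ ⟨
      suc m + 0 + 0                            ∎
      where open ≡-Reasoning

    a-to-inner : ∀ {y} → a ≢ y → δ a y ≡ suc (pos y) + 0 + height y
    a-to-inner {y} a≢y = begin
      δ a y                                    ≡⟨ δ-≢ a≢y ⟩
      height a + ∣ pos a - pos y ∣ + height y ≡⟨ cong₂ (λ h d → h + d + height y) height-a (cong (∣_- pos y ∣) pos-a) ⟩
      suc (pos y) + height y                   ≡⟨ cong (_+ height y) (+-identityʳ _) ⟨
      suc (pos y) + 0 + height y               ∎
      where open ≡-Reasoning

    b-to-inner : ∀ {y} → b ≢ y → δ b y ≡ ∣ m - pos y ∣ + 0 + height y
    b-to-inner {y} b≢y = begin
      δ b y                                    ≡⟨ δ-≢ b≢y ⟩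
      height b + ∣ pos b - pos y ∣ + height y ≡⟨ cong (λ h → h + ∣ pos b - pos y ∣ + height y) height-b ⟩
      suc ∣ pos b - pos y ∣ + height y         ≡⟨ cong (_+ height y) (∣1+m-n∣≡1+∣m-n∣ (s≤s⁻¹ y<m)) ⟨
      ∣ suc (pos b) - pos y ∣ + height y       ≡⟨ cong (λ k → ∣ k - pos y ∣ + height y) pos-b ⟩
      ∣ m - pos y ∣ + height y                 ≡⟨ cong (_+ height y) (+-identityʳ _) ⟨
      ∣ m - pos y ∣ + 0 + height y             ∎
      where
      open ≡-Reasoning
      y<m : pos y < suc (pos b)
      y<m = subst (pos y <_) (sym pos-b) (Finₚ.toℕ<n (anchor y))

    inner-to-inner : ∀ {x y} → x ≢ y → δ x y ≡ ∣ pos x - pos y ∣ + height x + height y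
    inner-to-inner {x} {y} x≢y = trans (δ-≢ x≢y) (cong (_+ height y) (+-comm (height x) _))

    formula : ∀ {x y} (vx : EndView x) (vy : EndView y) → x ≢ y → Formula vx vy
    formula (is-a refl)   (is-a refl)   a≢a = ⊥-elim (a≢a refl)
    formula (is-a refl)   (is-b refl)   _   = a-to-b
    formula (is-a refl)   (inner _ _)   a≢y = a-to-inner a≢y
    formula (is-b refl)   (is-a refl)   _   = flip (is-b refl) (is-a refl) a-to-b
    formula (is-b refl)   (is-b refl)   b≢b = ⊥-elim (b≢b refl)
    formula (is-b refl)   (inner _ _)   b≢y = b-to-inner b≢y
    formula vx@(inner _ _) (is-a refl) x≢a = flip vx (is-a refl) (a-to-inner (x≢a ∘ sym))
    formula vx@(inner _ _) (is-b refl) x≢b = flip vx (is-b refl) (b-to-inner (x≢b ∘ sym))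
    formula (inner _ _)   (inner _ _)   x≢y = inner-to-inner x≢y

  long-path-δ : ∀ {x y} → x ≢ y → δ x y ≡ ∣ pathPos x - pathPos y ∣ + offPath x + offPath y
  long-path-δ {x} {y} = formula (endView x) (endView y)

  pathPos≤1+m : ∀ x → pathPos x ≤ suc m
  pathPos≤1+m x = go (endView x)
    where
    go : (v : EndView x) → pathPosOf v ≤ suc m
    go (is-a _)    = z≤n
    go (is-b _)    = ≤-refl
    go (inner _ _) = s≤s (<⇒≤ (Finₚ.toℕ<n (anchor x)))

  coords-a : pathPos a ≡ 0 × offPath a ≡ 0
  coords-a = go (endView a)
    where
    go : (v : EndView a) → pathPosOf v ≡ 0 × offPathOf v ≡ 0
    go (is-a _)      = refl , refl
    go (is-b a≡b)    = ⊥-elim (a≢b a≡b)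
    go (inner a≢a _) = ⊥-elim (a≢a refl)

  coords-b : pathPos b ≡ suc m × offPath b ≡ 0
  coords-b = go (endView b)
    where
    go : (v : EndView b) → pathPosOf v ≡ suc m × offPathOf v ≡ 0
    go (is-a b≡a)    = ⊥-elim (a≢b (sym b≡a))
    go (is-b _)      = refl , refl
    go (inner _ b≢b) = ⊥-elim (b≢b refl)

  coords-inner : ∀ {x} → x ≢ a → x ≢ b → pathPos x ≡ suc (pos x) × offPath x ≡ height x
  coords-inner {x} x≢a x≢b = go (endView x)
    where
    go : (v : EndView x) → pathPosOf v ≡ suc (pos x) × offPathOf v ≡ height x
    go (is-a x≡a)  = ⊥-elim (x≢a x≡a)
    go (is-b x≡b)  = ⊥-elim (x≢b x≡b)
    go (inner _ _) = refl , refl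

  coords-spine : ∀ i → pathPos (spine i) ≡ suc (toℕ i) × offPath (spine i) ≡ 0
  coords-spine i =
    let anchor≡i , height≡0 = locate-spine i
        pos≡ , off≡ = coords-inner (off-end height-a) (off-end height-b)
    in trans pos≡ (cong (suc ∘ toℕ) anchor≡i) , trans off≡ height≡0
    where
    off-end : ∀ {e} → height e ≡ 1 → spine i ≢ e
    off-end height-e refl with () ← trans (sym (proj₂ (locate-spine i))) height-e

  δ-from-a : ∀ y → δ a y ≡ pathPos y + offPath y
  δ-from-a y = go (a ≟ y)
    where
    go : Dec (a ≡ y) → δ a y ≡ pathPos y + offPath y
    go (yes refl) = trans (δ-refl a) (sym (cong₂ _+_ (proj₁ coords-a) (proj₂ coords-a)))
    go (no a≢y) rewrite long-path-δ a≢y | proj₁ coords-a | proj₂ coords-a = cong (_+ offPath y) (+-identityʳ _)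

  δ-from-b : ∀ y → δ b y ≡ (suc m ∸ pathPos y) + offPath y
  δ-from-b y = go (b ≟ y)
    where
    go : Dec (b ≡ y) → δ b y ≡ (suc m ∸ pathPos y) + offPath y
    go (yes refl) = trans (δ-refl b) (sym (cong₂ _+_ (trans (cong (suc m ∸_) (proj₁ coords-b)) (n∸n≡0 (suc m))) (proj₂ coords-b)))
    go (no b≢y) rewrite long-path-δ b≢y | proj₁ coords-b | proj₂ coords-b =
      cong (_+ offPath y) (trans (+-identityʳ _) (m≤n⇒∣n-m∣≡n∸m (pathPos≤1+m y)))

  δ-ends-sum : ∀ y → δ a y + δ b y ≡ suc m + (offPath y + offPath y)
  δ-ends-sum y = begin
    δ a y + δ b y                                  ≡⟨ cong₂ _+_ (δ-from-a y) (δ-from-b y) ⟩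
    (p + o) + ((suc m ∸ p) + o)                    ≡⟨ +-assoc p o _ ⟩
    p + (o + ((suc m ∸ p) + o))                    ≡⟨ cong (p +_) (+-assoc o (suc m ∸ p) o) ⟨
    p + ((o + (suc m ∸ p)) + o)                    ≡⟨ cong (λ k → p + (k + o)) (+-comm o (suc m ∸ p)) ⟩
    p + (((suc m ∸ p) + o) + o)                    ≡⟨ cong (p +_) (+-assoc (suc m ∸ p) o o) ⟩
    p + ((suc m ∸ p) + (o + o))                    ≡⟨ +-assoc p (suc m ∸ p) (o + o) ⟨
    p + (suc m ∸ p) + (o + o)                      ≡⟨ cong (_+ (o + o)) (m+[n∸m]≡n (pathPos≤1+m y)) ⟩
    suc m + (o + o)                                ∎
    where
    open ≡-Reasoning
    p = pathPos y
    o = offPath y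

  pathVertexAt : ∀ k → Dec (k < m) → Fin n
  pathVertexAt k (yes k<m) = spine (fromℕ< k<m)
  pathVertexAt k (no _)    = b

  pathVertex : ℕ → Fin n
  pathVertex zero    = a
  pathVertex (suc k) = pathVertexAt k (k <? m)

  pathVertex-coords : ∀ k → k ≤ suc m → pathPos (pathVertex k) ≡ k × offPath (pathVertex k) ≡ 0
  pathVertex-coords zero    _     = coords-a
  pathVertex-coords (suc k) k≤m with k <? m
  ... | yes k<m = let pos≡ , off≡ = coords-spine (fromℕ< k<m) in trans pos≡ (cong suc (Finₚ.toℕ-fromℕ< k<m)) , off≡
  ... | no  k≮m rewrite ≤-antisym (s≤s⁻¹ k≤m) (≮⇒≥ k≮m) = coords-b

  pathVertex-injective : ∀ {k l} → k ≤ suc m → l ≤ suc m → pathVertex k ≡ pathVertex l → k ≡ l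
  pathVertex-injective {k} {l} k≤ l≤ e =
    trans (sym (proj₁ (pathVertex-coords k k≤))) (trans (cong pathPos e) (proj₁ (pathVertex-coords l l≤)))

  pathVertex-pathPos : ∀ y → offPath y ≡ 0 → pathVertex (pathPos y) ≡ y
  pathVertex-pathPos y = go (endView y)
    where
    go : (v : EndView y) → offPathOf v ≡ 0 → pathVertex (pathPosOf v) ≡ y
    go (is-a refl) _ = refl
    go (is-b refl) _ with m <? m
    ... | yes m<m = ⊥-elim (<-irrefl refl m<m)
    ... | no  _   = refl
    go (inner _ _) height≡0 with pos y <? m | placement y
    ... | yes y<m | on-spine e _ = trans (cong spine (Finₚ.fromℕ<-toℕ (anchor y) y<m)) e
    ... | no  y≮m | _ = ⊥-elim (y≮m (Finₚ.toℕ<n (anchor y)))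
    ... | _ | pendant _ _ height≡1 with () ← trans (sym height≡0) height≡1

  on-path⇒IsPathGraph : (∀ c → offPath c ≡ 0) → IsPathGraph G
  on-path⇒IsPathGraph on-path = suc (suc m) , w ,
    (λ e → Finₚ.toℕ-injective (pathVertex-injective (toℕ≤ _) (toℕ≤ _) e)) ,
    (λ y → mk⇔ (λ _ → fromℕ< (s≤s (pathPos≤1+m y)) , trans (cong pathVertex (Finₚ.toℕ-fromℕ< (s≤s (pathPos≤1+m y)))) (pathVertex-pathPos y (on-path y)))
               (λ _ → refl)) ,
    adjacent⇔
    where
    w : Fin (suc (suc m)) → Fin n
    w i = pathVertex (toℕ i)
    toℕ≤ : ∀ (i : Fin (suc (suc m))) → toℕ i ≤ suc m
    toℕ≤ i = s≤s⁻¹ (Finₚ.toℕ<n i)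
    δ-w : ∀ i j → i ≢ j → δ (w i) (w j) ≡ ∣ toℕ i - toℕ j ∣
    δ-w i j i≢j = begin
      δ (w i) (w j)                                           ≡⟨ long-path-δ (i≢j ∘ Finₚ.toℕ-injective ∘ pathVertex-injective (toℕ≤ i) (toℕ≤ j)) ⟩
      ∣ pathPos (w i) - pathPos (w j) ∣ + offPath (w i) + offPath (w j)
        ≡⟨ cong₂ (λ p q → ∣ p - q ∣ + offPath (w i) + offPath (w j)) (proj₁ (pathVertex-coords _ (toℕ≤ i))) (proj₁ (pathVertex-coords _ (toℕ≤ j))) ⟩
      ∣ toℕ i - toℕ j ∣ + offPath (w i) + offPath (w j)
        ≡⟨ cong₂ (λ o o′ → ∣ toℕ i - toℕ j ∣ + o + o′) (proj₂ (pathVertex-coords _ (toℕ≤ i))) (proj₂ (pathVertex-coords _ (toℕ≤ j))) ⟩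
      ∣ toℕ i - toℕ j ∣ + 0 + 0                                 ≡⟨ trans (+-identityʳ _) (+-identityʳ _) ⟩
      ∣ toℕ i - toℕ j ∣                                          ∎
      where open ≡-Reasoning
    adjacent⇔ : ∀ i j → Adj G (w i) (w j) ⇔ Consecutive (toℕ i) (toℕ j)
    adjacent⇔ i j with i Fin.≟ j
    ... | yes refl = mk⇔ (⊥-elim ∘ Adj-irrefl G) λ { (inj₁ e) → ⊥-elim (1+n≢n e) ; (inj₂ e) → ⊥-elim (1+n≢n e) }
    ... | no  i≢j = mk⇔ (λ ij → ∣-∣≡1⇒Consecutive _ _ (trans (sym (δ-w i j i≢j)) (Adj⇒δ≡1 ij)))
                        (λ c → δ≡1⇒Adj (trans (δ-w i j i≢j) (Consecutive⇒∣-∣≡1 c)))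

  off-path-vertex : ¬ IsPathGraph G → ∃[ c ] offPath c ≢ 0
  off-path-vertex not-path =
    Finₚ.¬∀⟶∃¬ n (λ c → offPath c ≡ 0) (λ c → offPath c ℕ.≟ 0) (not-path ∘ on-path⇒IsPathGraph)

  3+m≤n : ¬ IsPathGraph G → suc (suc (suc m)) ≤ n
  3+m≤n not-path = Finₚ.injective⇒≤ {f = v} v-injective
    where
    c = proj₁ (off-path-vertex not-path)
    v : Fin (suc (suc (suc m))) → Fin n
    v zero    = c
    v (suc i) = pathVertex (toℕ i)
    c-off : ∀ (i : Fin (suc (suc m))) → c ≢ pathVertex (toℕ i)
    c-off i c≡v = proj₂ (off-path-vertex not-path) (trans (cong offPath c≡v) (proj₂ (pathVertex-coords _ (s≤s⁻¹ (Finₚ.toℕ<n i)))))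
    v-injective : ∀ {i j} → v i ≡ v j → i ≡ j
    v-injective {zero}  {zero}  _ = refl
    v-injective {zero}  {suc j} e = ⊥-elim (c-off j e)
    v-injective {suc i} {zero}  e = ⊥-elim (c-off i (sym e))
    v-injective {suc i} {suc j} e =
      cong suc (Finₚ.toℕ-injective (pathVertex-injective (s≤s⁻¹ (Finₚ.toℕ<n i)) (s≤s⁻¹ (Finₚ.toℕ<n j)) e))

  diam≡1+m : suc m ≤ n → diam G ≡ suc m
  diam≡1+m 1+m≤n = ≤-antisym
    (diam-≤ G (λ u v → ≤-trans (≤-reflexive (dist≡δ 1+m≤n u v)) (δ-≤-1+m u v)))
    (≤-trans (≤-reflexive (sym dist-a-b)) (dist-≤-diam G a b))
    where
    dist-a-b : dist G a b ≡ suc m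
    dist-a-b = trans (dist≡δ 1+m≤n a b) (trans (δ-from-a b) (trans (cong₂ _+_ (proj₁ coords-b) (proj₂ coords-b)) (+-identityʳ _)))

  onPath : Fin n → ℕ
  onPath y = count {suc (suc m)} (λ k → ⌊ pathVertex (toℕ k) ≟ y ⌋)

  ∑-onPath : sum onPath ≡ suc (suc m)
  ∑-onPath = begin
    ∑[ y < n ] ∑[ k < suc (suc m) ] ι k y ≡⟨ ∑-comm {n} {suc (suc m)} (λ y k → ι k y) ⟩
    ∑[ k < suc (suc m) ] ∑[ y < n ] ι k y ≡⟨ sum-cong-≗ {suc (suc m)} each-once ⟩
    ∑[ k < suc (suc m) ] 1                 ≡⟨ trans (∑-const (suc (suc m)) 1) (*-identityʳ _) ⟩
    suc (suc m)                            ∎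
    where
    open ≡-Reasoning
    ι : Fin (suc (suc m)) → Fin n → ℕ
    ι k y = if ⌊ pathVertex (toℕ k) ≟ y ⌋ then 1 else 0
    each-once : ∀ k → ∑[ y < n ] ι k y ≡ 1
    each-once k = count-≡1 (λ y → ⌊ pathVertex (toℕ k) ≟ y ⌋) {pathVertex (toℕ k)} (to T-≡ (fromWitness refl))
                    (λ y e → sym (toWitness (from T-≡ e)))

  1≤offPath+onPath : ∀ y → 1 ≤ offPath y + onPath y
  1≤offPath+onPath y with offPath y ℕ.≟ 0
  ... | no  off≢0 = ≤-trans (n≢0⇒n>0 off≢0) (m≤m+n _ _)
  ... | yes off≡0 = ≤-trans (count-≥1 {suc (suc m)} (λ k → ⌊ pathVertex (toℕ k) ≟ y ⌋) {fromℕ< p<} (to T-≡ (fromWitness on))) (m≤n+m (onPath y) (offPath y))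
    where
    p< = s≤s (pathPos≤1+m y)
    on : pathVertex (toℕ (fromℕ< p<)) ≡ y
    on = trans (cong pathVertex (Finₚ.toℕ-fromℕ< p<)) (pathVertex-pathPos y off≡0)

  ends-transmission : suc m ≤ n →
    suc (suc (suc m)) * n ≤ transmission G a + transmission G b + suc (suc m) * 2
  ends-transmission 1+m≤n = begin
    suc (suc (suc m)) * n                               ≡⟨ *-comm (suc (suc (suc m))) n ⟩
    n * suc (suc (suc m))                               ≡⟨ ∑-const n (suc (suc (suc m))) ⟨
    ∑[ y < n ] suc (suc (suc m))                        ≤⟨ ∑-mono-≤ pointwise ⟩
    ∑[ y < n ] (δ a y + δ b y + (onPath y + onPath y))  ≡⟨ ∑-distrib-+ (λ y → δ a y + δ b y) _ ⟩
    sum (λ y → δ a y + δ b y) + sum (λ y → onPath y + onPath y)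
                                                        ≡⟨ cong₂ _+_ (∑-distrib-+ (δ a) (δ b)) (∑-distrib-+ onPath onPath) ⟩
    sum (δ a) + sum (δ b) + (sum onPath + sum onPath)   ≡⟨ cong₂ (λ s t → s + t + (sum onPath + sum onPath)) (transmission-δ a) (transmission-δ b) ⟨
    transmission G a + transmission G b + (sum onPath + sum onPath)
                                                        ≡⟨ cong (λ s → transmission G a + transmission G b + (s + s)) ∑-onPath ⟩
    transmission G a + transmission G b + (suc (suc m) + suc (suc m))
                                                        ≡⟨ cong (transmission G a + transmission G b +_) (sym (trans (*-comm (suc (suc m)) 2) (cong (suc (suc m) +_) (+-identityʳ _)))) ⟩
    transmission G a + transmission G b + suc (suc m) * 2 ∎
    where
    open ≤-Reasoning
    transmission-δ : ∀ x → transmission G x ≡ sum (δ x)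
    transmission-δ x = trans (transmission-∑ G x) (sum-cong-≗ (dist≡δ 1+m≤n x))
    pointwise : ∀ y → suc (suc (suc m)) ≤ δ a y + δ b y + (onPath y + onPath y)
    pointwise y = begin
      suc (suc (suc m))                                ≡⟨ +-comm 2 (suc m) ⟩
      suc m + 2                                        ≤⟨ +-monoʳ-≤ (suc m) (+-mono-≤ (1≤offPath+onPath y) (1≤offPath+onPath y)) ⟩
      suc m + ((o + P) + (o + P))                      ≡⟨ regroup (suc m) o P ⟩
      suc m + (o + o) + (P + P)                        ≡⟨ cong (_+ (P + P)) (δ-ends-sum y) ⟨
      δ a y + δ b y + (P + P)                          ∎
      where
      o = offPath y
      P = onPath y
      regroup : ∀ s o P → s + ((o + P) + (o + P)) ≡ s + (o + o) + (P + P)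
      regroup = solve 3 (λ s o P → s :+ ((o :+ P) :+ (o :+ P)) := s :+ (o :+ o) :+ (P :+ P)) refl

module _ {n : ℕ} (G : Graph n) where

  single-vertex⇒IsPathGraph : ∀ u → (∀ y → y ≡ u) → IsPathGraph G
  single-vertex⇒IsPathGraph u all-u = 1 , (λ _ → u) , (λ { {zero} {zero} _ → refl }) ,
    (λ x → mk⇔ (λ _ → zero , sym (all-u x)) (λ _ → refl)) ,
    λ { zero zero → mk⇔ (⊥-elim ∘ Adj-irrefl G) λ { (inj₁ ()) ; (inj₂ ()) } }

  edge⇒IsPathGraph : ∀ {x z} → Adj G x z → (∀ y → y ≡ x ⊎ y ≡ z) → IsPathGraph G
  edge⇒IsPathGraph {x} {z} xz all-xz = 2 , ends , ends-injective , (λ y → mk⇔ (λ _ → onto y) (λ _ → refl)) , adjacent⇔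
    where
    ends : Fin 2 → Fin n
    ends zero    = x
    ends (suc _) = z
    ends-injective : ∀ {i j} → ends i ≡ ends j → i ≡ j
    ends-injective {zero}     {zero}     _ = refl
    ends-injective {zero}     {suc zero} e = ⊥-elim (Adj⇒≢ G xz e)
    ends-injective {suc zero} {zero}     e = ⊥-elim (Adj⇒≢ G xz (sym e))
    ends-injective {suc zero} {suc zero} _ = refl
    onto : ∀ y → ∃[ i ] ends i ≡ y
    onto y with all-xz y
    ... | inj₁ y≡x = zero , sym y≡x
    ... | inj₂ y≡z = suc zero , sym y≡z
    adjacent⇔ : ∀ i j → Adj G (ends i) (ends j) ⇔ Consecutive (toℕ i) (toℕ j)
    adjacent⇔ zero       zero       = mk⇔ (⊥-elim ∘ Adj-irrefl G) λ { (inj₁ ()) ; (inj₂ ()) }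
    adjacent⇔ zero       (suc zero) = mk⇔ (λ _ → inj₁ refl) (λ _ → xz)
    adjacent⇔ (suc zero) zero       = mk⇔ (λ _ → inj₂ refl) (λ _ → Adj-sym G xz)
    adjacent⇔ (suc zero) (suc zero) = mk⇔ (⊥-elim ∘ Adj-irrefl G) λ { (inj₁ ()) ; (inj₂ ()) }

  some-neighbour : Connected G → ¬ IsPathGraph G → ∀ u → ∃[ z ] Adj G u z
  some-neighbour connected not-path u with deg G u in deg-u
  ... | suc _ = count-witness (adj G u) (≤-trans (s≤s z≤n) (≤-reflexive (trans (sym deg-u) (deg-count G u))))
  ... | zero  = ⊥-elim (not-path (single-vertex⇒IsPathGraph u alone))
    where
    alone : ∀ y → y ≡ u
    alone y with connected u y
    ... | _ , here = refl
    ... | _ , step uz _ = ⊥-elim (<⇒≱ (count-≥1 (adj G u) uz) (≤-reflexive (trans (sym (deg-count G u)) deg-u)))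

  other-neighbour : ∀ {u z} → deg G u ≢ 1 → Adj G u z → ∃[ z′ ] z′ ≢ z × Adj G u z′
  other-neighbour {u} {z} deg≢1 uz with Finₚ.any? (λ z′ → ¬? (z′ ≟ z) ×-dec (adj G u z′ Data.Bool.≟ true))
  ... | yes (z′ , z′≢z , uz′) = z′ , z′≢z , uz′
  ... | no none = ⊥-elim (deg≢1 (trans (deg-count G u) (count-≡1 (adj G u) uz only-z)))
    where
    only-z : ∀ y → Adj G u y → y ≡ z
    only-z y uy with y ≟ z
    ... | yes y≡z = y≡z
    ... | no  y≢z = ⊥-elim (none (y , y≢z , uy))

  isolated-edge : Connected G → ∀ {x z} → PendantAt G x z → PendantAt G z x → ∀ y → y ≡ x ⊎ y ≡ z
  isolated-edge connected {x} {z} (_ , x-only) (_ , z-only) y = stays (proj₂ (connected x y)) (inj₁ refl)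
    where
    stays : ∀ {u v k} → Walk G u v k → u ≡ x ⊎ u ≡ z → v ≡ x ⊎ v ≡ z
    stays here            at = at
    stays (step uw p) (inj₁ refl) = stays p (inj₂ (x-only _ uw))
    stays (step uw p) (inj₂ refl) = stays p (inj₁ (z-only _ uw))

  deg≡1⇒PendantAt : ∀ {x z} → deg G x ≡ 1 → Adj G x z → PendantAt G x z
  deg≡1⇒PendantAt {x} {z} deg≡1 xz = xz , only-z
    where
    only-z : ∀ y → Adj G x y → y ≡ z
    only-z y xy with y ≟ z
    ... | yes y≡z = y≡z
    ... | no  y≢z = ⊥-elim (<⇒≱ (≤-reflexive refl) (≤-trans (count-≥2 (adj G x) xy xz y≢z) (≤-reflexive (trans (sym (deg-count G x)) deg≡1))))

  IsCaterpillar⇒Caterpillar : Connected G → ¬ IsPathGraph G → InducesPath G (λ v → not (isLeaf G v)) →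
                              Σ (Caterpillar G) λ C → ∀ i → deg G (Caterpillar.spine C i) ≢ 1
  IsCaterpillar⇒Caterpillar connected not-path (m , spine , spine-injective , nonleaf⇔ , adj⇔) =
    record { m = m ; spine = spine ; spine-injective = spine-injective
           ; spine-adj = λ i j i+1≡j → from (adj⇔ i j) (inj₁ i+1≡j)
           ; spine-adj⁻ = λ i j → to (adj⇔ i j)
           ; locate = locate } ,
    spine-deg≢1
    where
    spine-deg≢1 : ∀ i → deg G (spine i) ≢ 1
    spine-deg≢1 i deg≡1 with () ← trans (sym (from (nonleaf⇔ (spine i)) (i , refl))) (cong not (deg≡1⇒isLeaf G deg≡1))
    off-spine-deg≡1 : ∀ x → ¬ (∃[ i ] spine i ≡ x) → deg G x ≡ 1
    off-spine-deg≡1 x off with isLeaf G x in leaf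
    ... | true  = isLeaf⇒deg≡1 G leaf
    ... | false = ⊥-elim (off (to (nonleaf⇔ x) (cong not leaf)))
    on-spine? : ∀ x → Relation.Nullary.Dec (∃[ i ] spine i ≡ x)
    on-spine? x = Finₚ.any? (λ i → spine i ≟ x)
    locate : ∀ x → Located G spine x
    locate x with on-spine? x
    ... | yes on = inj₁ on
    ... | no off with z , xz ← some-neighbour connected not-path x with on-spine? z
    ...   | yes (i , refl) = inj₂ (i , deg≡1⇒PendantAt (off-spine-deg≡1 x off) xz , λ j e → off (j , e))
    ...   | no z-off = ⊥-elim (not-path (edge⇒IsPathGraph xz (isolated-edge connected x-pendant z-pendant)))
      where
      x-pendant = deg≡1⇒PendantAt (off-spine-deg≡1 x off) xz
      z-pendant = deg≡1⇒PendantAt (off-spine-deg≡1 z z-off) (Adj-sym G xz)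

module _ {n : ℕ} {G : Graph n} (C : Caterpillar G) where
  open Caterpillar C
  open CaterpillarMetric C

  off-spine-neighbour : ∀ {i z} → Adj G (spine i) z → (∀ j → spine j ≢ z) → anchor z ≡ i × height z ≡ 1
  off-spine-neighbour {i} {z} iz off with placement z
  ... | on-spine e _             = ⊥-elim (off _ e)
  ... | pendant (_ , only) _ h≡1 = spine-injective (sym (only _ (Adj-sym G iz))) , h≡1

  end-leaf : (∀ i → deg G (spine i) ≢ 1) → ∀ {e s} → Adj G (spine e) (spine s) →
             (∀ j → Adj G (spine e) (spine j) → j ≡ s) → ∃[ z ] anchor z ≡ e × height z ≡ 1
  end-leaf spine-deg≢1 es only-s with z , z≢s , ez ← other-neighbour G (spine-deg≢1 _) es =
    z , off-spine-neighbour ez (λ j e → z≢s (trans (sym e) (cong spine (only-s j (subst (Adj G _) (sym e) ez)))))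

  module _ (connected : Connected G) (not-path : ¬ IsPathGraph G) (spine-deg≢1 : ∀ i → deg G (spine i) ≢ 1) where

    single-spine-vertex-ends : m ≡ 1 → Ends C
    single-spine-vertex-ends m≡1 = record
      { a = z₁ ; b = z₂ ; a≢b = z₂≢z₁ ∘ sym
      ; height-a = proj₂ (at-0 0z₁) ; height-b = proj₂ (at-0 0z₂)
      ; pos-a = pos-0 0z₁
      ; pos-b = trans (cong suc (pos-0 0z₂)) (sym m≡1) }
      where
      0<m = ≤-reflexive (sym m≡1)
      0F = fromℕ< {0} 0<m
      at-0 : ∀ {z} → Adj G (spine 0F) z → anchor z ≡ 0F × height z ≡ 1
      at-0 0z = off-spine-neighbour 0z λ { j refl → Adj⇒≢ G 0z (cong spine (Finₚ.toℕ-injective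
                  (trans (Finₚ.toℕ-fromℕ< 0<m) (sym (n<1⇒n≡0 (subst (toℕ j <_) m≡1 (Finₚ.toℕ<n j))))))) }
      pos-0 : ∀ {z} → Adj G (spine 0F) z → pos z ≡ 0
      pos-0 0z = trans (cong toℕ (proj₁ (at-0 0z))) (Finₚ.toℕ-fromℕ< 0<m)
      z₁ = proj₁ (some-neighbour G connected not-path (spine 0F))
      0z₁ = proj₂ (some-neighbour G connected not-path (spine 0F))
      z₂ = proj₁ (other-neighbour G (spine-deg≢1 0F) 0z₁)
      z₂≢z₁ = proj₁ (proj₂ (other-neighbour G (spine-deg≢1 0F) 0z₁))
      0z₂ = proj₂ (proj₂ (other-neighbour G (spine-deg≢1 0F) 0z₁))

    long-spine-ends : ∀ {k} → m ≡ suc (suc k) → Ends C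
    long-spine-ends {k} m≡2+k = record
      { a = proj₁ a-leaf ; b = proj₁ b-leaf ; a≢b = λ a≡b → 1+n≢0 (sym (trans (sym pos-a) (trans (cong pos a≡b) pos-b)))
      ; height-a = proj₂ (proj₂ a-leaf) ; height-b = proj₂ (proj₂ b-leaf)
      ; pos-a = pos-a ; pos-b = trans (cong suc pos-b) (sym m≡2+k) }
      where
      index : ∀ i → i ≤ suc k → Fin m
      index i i≤ = fromℕ< (subst (i <_) (sym m≡2+k) (s≤s i≤))
      toℕ-index : ∀ i (i≤ : i ≤ suc k) → toℕ (index i i≤) ≡ i
      toℕ-index i i≤ = Finₚ.toℕ-fromℕ< (subst (i <_) (sym m≡2+k) (s≤s i≤))
      first = index 0 z≤n
      second = index 1 (s≤s z≤n)
      last = index (suc k) ≤-refl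
      prev = index k (n≤1+n k)
      a-leaf = end-leaf spine-deg≢1 {first} {second} (spine-adj first second (trans (cong suc (toℕ-index 0 z≤n)) (sym (toℕ-index 1 (s≤s z≤n)))))
        λ j 0j → Finₚ.toℕ-injective (trans (from-first (spine-adj⁻ first j 0j)) (sym (toℕ-index 1 (s≤s z≤n))))
        where
        from-first : ∀ {j} → Consecutive (toℕ first) j → j ≡ 1
        from-first c with toℕ first | toℕ-index 0 z≤n
        from-first (inj₁ refl) | .0 | refl = refl
        from-first (inj₂ ())   | .0 | refl
      b-leaf = end-leaf spine-deg≢1 {last} {prev} (Adj-sym G (spine-adj prev last (trans (cong suc (toℕ-index k (n≤1+n k))) (sym (toℕ-index (suc k) ≤-refl)))))
        λ j lj → Finₚ.toℕ-injective (trans (from-last (Finₚ.toℕ<n j) (spine-adj⁻ last j lj)) (sym (toℕ-index k (n≤1+n k))))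
        where
        from-last : ∀ {j} → j < m → Consecutive (toℕ last) j → j ≡ k
        from-last j<m c with toℕ last | toℕ-index (suc k) ≤-refl
        from-last j<m (inj₁ refl) | .(suc k) | refl = ⊥-elim (<-irrefl (sym m≡2+k) j<m)
        from-last j<m (inj₂ e)    | .(suc k) | refl = suc-injective e
      pos-a : pos (proj₁ a-leaf) ≡ 0
      pos-a = trans (cong toℕ (proj₁ (proj₂ a-leaf))) (toℕ-index 0 z≤n)
      pos-b : pos (proj₁ b-leaf) ≡ suc k
      pos-b = trans (cong toℕ (proj₁ (proj₂ b-leaf))) (toℕ-index (suc k) ≤-refl)

    caterpillar-ends : Fin m → Ends C
    caterpillar-ends i = by-length (inhabited⇒≡suc i)
      where
      inhabited⇒≡suc : ∀ {k} → Fin k → k ≡ suc (ℕ.pred k)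
      inhabited⇒≡suc zero    = refl
      inhabited⇒≡suc (suc _) = refl
      by-length : ∀ {k} → m ≡ suc k → Ends C
      by-length {zero}  m≡1   = single-spine-vertex-ends m≡1
      by-length {suc k} m≡2+k = long-spine-ends m≡2+k

2*∑toℕ : ∀ s → (∑[ l < suc s ] toℕ l) * 2 ≡ s * suc s
2*∑toℕ zero    = refl
2*∑toℕ (suc s) = begin
  (∑[ l < suc (suc s) ] toℕ l) * 2                         ≡⟨ cong (_* 2) (sum-init-last {suc s} toℕ) ⟩
  (∑[ l < suc s ] toℕ (Fin.inject₁ l) + toℕ (Fin.fromℕ (suc s))) * 2
    ≡⟨ cong₂ (λ t u → (t + u) * 2) (sum-cong-≗ {suc s} {λ l → toℕ (Fin.inject₁ l)} {toℕ} Finₚ.toℕ-inject₁)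
                                   (Finₚ.toℕ-fromℕ (suc s)) ⟩
  (∑[ l < suc s ] toℕ l + suc s) * 2                       ≡⟨ *-distribʳ-+ 2 (∑[ l < suc s ] toℕ l) (suc s) ⟩
  (∑[ l < suc s ] toℕ l) * 2 + suc s * 2                    ≡⟨ cong (_+ suc s * 2) (2*∑toℕ s) ⟩
  s * suc s + suc s * 2                                    ≡⟨ solve 1 (λ s → s :* (con 1 :+ s) :+ (con 1 :+ s) :* con 2 := (con 1 :+ s) :* (con 2 :+ s)) refl s ⟩
  suc s * suc (suc s)                                      ∎
  where open ≡-Reasoning

gauss : ∀ q s → (∑[ l < suc (q + s) ] ∣ q - toℕ l ∣) * 2 ≡ q * suc q + s * suc s
gauss zero    s = 2*∑toℕ s
gauss (suc q) s = begin
  (suc q + ∑[ l < suc (q + s) ] ∣ q - toℕ l ∣) * 2      ≡⟨ *-distribʳ-+ 2 (suc q) _ ⟩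
  suc q * 2 + (∑[ l < suc (q + s) ] ∣ q - toℕ l ∣) * 2  ≡⟨ cong (suc q * 2 +_) (gauss q s) ⟩
  suc q * 2 + (q * suc q + s * suc s)                   ≡⟨ solve 2 (λ q t → (con 1 :+ q) :* con 2 :+ (q :* (con 1 :+ q) :+ t) := (con 1 :+ q) :* (con 2 :+ q) :+ t) refl q (s * suc s) ⟩
  suc q * suc (suc q) + s * suc s                       ∎
  where open ≡-Reasoning

∑-alternating : ∀ o → o ≤ 1 → ∀ L → (∑[ j < L ] ∣ o - toℕ j % 2 ∣) * 2 ≤ suc L
∑-alternating o o≤1 zero          = z≤n
∑-alternating zero       _ (suc zero) = z≤n
∑-alternating (suc zero) _ (suc zero) = ≤-refl
∑-alternating zero       o≤1 (suc (suc L)) = s≤s (s≤s (∑-alternating zero o≤1 L))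
∑-alternating (suc zero) o≤1 (suc (suc L)) = s≤s (s≤s (∑-alternating (suc zero) o≤1 L))
∑-alternating (suc (suc _)) (s≤s ()) _

sq+sq≤ : ∀ q s → q * suc q + s * suc s ≤ (q + s) * suc (q + s)
sq+sq≤ q s = ≤-trans (m≤m+n _ (q * s * 2)) (≤-reflexive
  (solve 2 (λ q s → q :* (con 1 :+ q) :+ s :* (con 1 :+ s) :+ q :* s :* con 2 := (q :+ s) :* (con 1 :+ (q :+ s))) refl q s))

-- The two inequalities between polynomials that close the bound on transmissions in the balanced caterpillar;
-- each is an identity after adding an explicit nonnegative remainder.
path-vertex-polynomial : ∀ h r D L → h + h + r ≡ suc D → r ≤ 1 →
  suc D * suc (suc D) + (h * L * 2 + r * suc L) + L * 2 + (D * 2 + 3) ≤ (D + 3) * (suc (suc D) + L)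
path-vertex-polynomial zero zero D L () _
path-vertex-polynomial (suc h) zero D L 2h≡1+D _ with refl ← suc-injective 2h≡1+D =
  ≤-trans (m≤m+n _ 1) (≤-reflexive (solve 2 (λ h L →
    let H = con 1 :+ h ; D = h :+ (con 1 :+ h) :+ con 0 in
    (con 1 :+ D) :* (con 2 :+ D) :+ (H :* L :* con 2 :+ con 0 :* (con 1 :+ L)) :+ L :* con 2 :+ (D :* con 2 :+ con 3) :+ con 1
      := (D :+ con 3) :* (con 2 :+ D :+ L)) refl h L))
path-vertex-polynomial h (suc zero) D L 2h+1≡1+D _ with refl ← suc-injective (trans (+-comm 1 (h + h)) 2h+1≡1+D) =
  ≤-reflexive (solve 2 (λ h L →
    let D = h :+ h in
    (con 1 :+ D) :* (con 2 :+ D) :+ (h :* L :* con 2 :+ con 1 :* (con 1 :+ L)) :+ L :* con 2 :+ (D :* con 2 :+ con 3)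
      := (D :+ con 3) :* (con 2 :+ D :+ L)) refl h L)
path-vertex-polynomial h (suc (suc r)) D L _ (s≤s ())

leaf-polynomial : ∀ h r o D L → h + h + r ≡ suc D → 1 ≤ h → r ≤ 1 → o ≤ 1 →
  (h + r * o) * suc (h + r * o) + (h + r * ∣ 1 - o ∣) * suc (h + r * ∣ 1 - o ∣) + suc (suc D) * 2 + r * suc L + L * 4 + (D * 2 + 3)
    ≤ (D + 3) * (suc (suc D) + L) + 4
leaf-polynomial (suc h) zero o D L 2h≡1+D _ _ _ with refl ← suc-injective 2h≡1+D =
  ≤-trans (m≤m+n _ (h * h * 2 + 1 + h * L * 2)) (≤-reflexive (solve 2 (λ h L →
    let H = con 1 :+ h ; D = h :+ (con 1 :+ h) :+ con 0 in
    (H :+ con 0) :* (con 1 :+ (H :+ con 0)) :+ (H :+ con 0) :* (con 1 :+ (H :+ con 0)) :+ (con 2 :+ D) :* con 2 :+ con 0 :+ L :* con 4 :+ (D :* con 2 :+ con 3)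
      :+ (h :* h :* con 2 :+ con 1 :+ h :* L :* con 2)
      := (D :+ con 3) :* (con 2 :+ D :+ L) :+ con 4) refl h L))
leaf-polynomial (suc h) (suc zero) zero D L 2h+1≡1+D _ _ _ with refl ← suc-injective (trans (+-comm 1 (suc h + suc h)) 2h+1≡1+D) =
  ≤-trans (m≤m+n _ (h * h * 2 + h * 2 + h * L * 2)) (≤-reflexive (solve 2 (λ h L →
    let H = con 1 :+ h ; D = H :+ H in
    (H :+ con 0) :* (con 1 :+ (H :+ con 0)) :+ (H :+ con 1) :* (con 1 :+ (H :+ con 1)) :+ (con 2 :+ D) :* con 2 :+ con 1 :* (con 1 :+ L) :+ L :* con 4 :+ (D :* con 2 :+ con 3)
      :+ (h :* h :* con 2 :+ h :* con 2 :+ h :* L :* con 2)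
      := (D :+ con 3) :* (con 2 :+ D :+ L) :+ con 4) refl h L))
leaf-polynomial (suc h) (suc zero) (suc zero) D L 2h+1≡1+D _ _ _ with refl ← suc-injective (trans (+-comm 1 (suc h + suc h)) 2h+1≡1+D) =
  ≤-trans (m≤m+n _ (h * h * 2 + h * 2 + h * L * 2)) (≤-reflexive (solve 2 (λ h L →
    let H = con 1 :+ h ; D = H :+ H in
    (H :+ con 1) :* (con 1 :+ (H :+ con 1)) :+ (H :+ con 0) :* (con 1 :+ (H :+ con 0)) :+ (con 2 :+ D) :* con 2 :+ con 1 :* (con 1 :+ L) :+ L :* con 4 :+ (D :* con 2 :+ con 3)
      :+ (h :* h :* con 2 :+ h :* con 2 :+ h :* L :* con 2)
      := (D :+ con 3) :* (con 2 :+ D :+ L) :+ con 4) refl h L))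
leaf-polynomial (suc h) (suc zero) (suc (suc o)) D L _ _ _ (s≤s ())
leaf-polynomial (suc h) (suc (suc r)) o D L _ _ (s≤s ()) _

/-≤-/+½ : ∀ k T M → T * 2 ≤ M * 2 + suc k → (ℤ.+ T) ℚ./ suc k ℚ.≤ (ℤ.+ M) ℚ./ suc k ℚ.+ ½
/-≤-/+½ k T M 2T≤ = ℚₚ.toℚᵘ-cancel-≤
  (ℚᵘₚ.≤-respˡ-≃ (ℚᵘₚ.≃-sym (ℚₚ.toℚᵘ-fromℚᵘ (mkℚᵘ (ℤ.+ T) k))) (ℚᵘₚ.≤-respʳ-≃ (ℚᵘₚ.≃-sym rhs≃) unnormalised))
  where
  rhs≃ : ℚ.toℚᵘ ((ℤ.+ M) ℚ./ suc k ℚ.+ ½) ℚᵘ.≃ mkℚᵘ (ℤ.+ M) k ℚᵘ.+ mkℚᵘ (ℤ.+ 1) 1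
  rhs≃ = ℚᵘₚ.≃-trans (ℚₚ.toℚᵘ-homo-+ ((ℤ.+ M) ℚ./ suc k) ½)
                     (ℚᵘₚ.+-cong (ℚₚ.toℚᵘ-fromℚᵘ (mkℚᵘ (ℤ.+ M) k)) (ℚₚ.toℚᵘ-fromℚᵘ (mkℚᵘ (ℤ.+ 1) 1)))
  cross : T * suc (suc (k * 2)) ≤ (M * 2 + 1 * suc k) * suc k
  cross = ≤-trans (≤-reflexive (solve 2 (λ T k → T :* (con 2 :+ k :* con 2) := (T :* con 2) :* (con 1 :+ k)) refl T k))
            (≤-trans (*-monoˡ-≤ (suc k) 2T≤) (≤-reflexive (cong (λ z → (M * 2 + z) * suc k) (sym (*-identityˡ (suc k))))))
  unnormalised : mkℚᵘ (ℤ.+ T) k ℚᵘ.≤ mkℚᵘ (ℤ.+ M) k ℚᵘ.+ mkℚᵘ (ℤ.+ 1) 1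
  unnormalised = *≤* (subst₂ ℤ._≤_ (ℤₚ.pos-* T (suc (suc (k * 2))))
    (trans (ℤₚ.pos-* (M * 2 + 1 * suc k) (suc k)) (cong (ℤ._* ℤ.+ suc k)
      (trans (ℤₚ.pos-+ (M * 2) (1 * suc k)) (cong₂ ℤ._+_ (ℤₚ.pos-* M 2) (ℤₚ.pos-* 1 (suc k))))))
    (+≤+ cross))

≤-⊔-foldℚ : ∀ {p} (xs : List ℚ) → p ℚ.≤ 0ℚ ⊎ Any (p ℚ.≤_) xs → p ℚ.≤ foldr ℚ._⊔_ 0ℚ xs
≤-⊔-foldℚ = foldr-preservesᵒ (λ q r → [ (λ p≤q → ℚₚ.≤-trans p≤q (ℚₚ.p≤p⊔q q r)) , (λ p≤r → ℚₚ.≤-trans p≤r (ℚₚ.p≤q⊔p q r)) ]′) 0ℚ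

module _ {n : ℕ} (G : Graph n) where

  π≤remoteness : ∀ x → π G x ℚ.≤ remoteness G
  π≤remoteness x = ≤-⊔-foldℚ (map (π G) (allFin n)) (inj₂ (Any-map-allFin {P = π G x ℚ.≤_} (π G) x ℚₚ.≤-refl))

  0≤remoteness : 0ℚ ℚ.≤ remoteness G
  0≤remoteness = ≤-⊔-foldℚ (map (π G) (allFin n)) (inj₁ ℚₚ.≤-refl)

  remoteness-≤ : ∀ {R} → 0ℚ ℚ.≤ R → (∀ x → π G x ℚ.≤ R) → remoteness G ℚ.≤ R
  remoteness-≤ {R} 0≤R π≤R = foldr-preservesᵇ {P = ℚ._≤ R} ℚₚ.⊔-lub 0≤R (All-map-allFin (π G) π≤R)

-- The graph on vertices 0 … D+1+L: the path 0 – 1 – … – D+1 together with L leaves,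
-- leaf j hanging at the vertex foot j of the path.
module Balanced (D L : ℕ) (1≤D : 1 ≤ D) where

  N : ℕ
  N = suc (suc D) + L

  h r : ℕ
  h = suc D / 2
  r = suc D % 2

  -- The leaves alternate between the middle vertex (or the two middle vertices) h and h + r of the path.
  foot : ℕ → ℕ
  foot j = h + r * (j % 2)

  h+h+r≡1+D : h + h + r ≡ suc D
  h+h+r≡1+D = begin
    h + h + r     ≡⟨ +-comm (h + h) r ⟩
    r + (h + h)   ≡⟨ cong (r +_) (trans (*-comm h 2) (cong (h +_) (+-identityʳ h))) ⟨
    r + h * 2     ≡⟨ m≡m%n+[m/n]*n (suc D) 2 ⟨
    suc D         ∎
    where open ≡-Reasoning

  r≤1 : r ≤ 1
  r≤1 = s≤s⁻¹ (m%n<n (suc D) 2)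

  1≤h : 1 ≤ h
  1≤h with h | h+h+r≡1+D
  ... | suc _ | _ = s≤s z≤n
  ... | zero  | 0+0+r≡1+D = ⊥-elim (<⇒≱ (s≤s 1≤D) (subst (_≤ 1) 0+0+r≡1+D r≤1))

  %2≤1 : ∀ j → j % 2 ≤ 1
  %2≤1 j = s≤s⁻¹ (m%n<n j 2)

  r*o≤r : ∀ {o} → o ≤ 1 → r * o ≤ r
  r*o≤r {o} o≤1 = ≤-trans (*-monoʳ-≤ r o≤1) (≤-reflexive (*-identityʳ r))

  1≤foot : ∀ j → 1 ≤ foot j
  1≤foot j = ≤-trans 1≤h (m≤m+n h _)

  foot≤D : ∀ j → foot j ≤ D
  foot≤D j = s≤s⁻¹ (begin
    suc (h + r * (j % 2)) ≤⟨ s≤s (+-monoʳ-≤ h (r*o≤r (%2≤1 j))) ⟩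
    1 + (h + r)           ≤⟨ +-monoˡ-≤ (h + r) 1≤h ⟩
    h + (h + r)           ≡⟨ +-assoc h h r ⟨
    h + h + r             ≡⟨ h+h+r≡1+D ⟩
    suc D                 ∎)
    where open ≤-Reasoning

  coordsAt : ∀ k → Dec (k ≤ suc D) → ℕ × ℕ
  coordsAt k (yes _) = k , 0
  coordsAt k (no _)  = foot (k ∸ suc (suc D)) , 1

  P e : ℕ → ℕ
  P k = proj₁ (coordsAt k (k ≤? suc D))
  e k = proj₂ (coordsAt k (k ≤? suc D))

  coords-path : ∀ {k} → k ≤ suc D → P k ≡ k × e k ≡ 0
  coords-path {k} k≤ with k ≤? suc D
  ... | yes _ = refl , refl
  ... | no k≰ = ⊥-elim (k≰ k≤)

  coords-off-path : ∀ {k} → suc (suc D) ≤ k → P k ≡ foot (k ∸ suc (suc D)) × e k ≡ 1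
  coords-off-path {k} k≥ with k ≤? suc D
  ... | yes k≤ = ⊥-elim (<⇒≱ (s≤s k≤) k≥)
  ... | no  _  = refl , refl

  coords-leaf : ∀ j → P (suc (suc D) + j) ≡ foot j × e (suc (suc D) + j) ≡ 1
  coords-leaf j = let P≡ , e≡ = coords-off-path (m≤m+n (suc (suc D)) j) in
    trans P≡ (cong foot (m+n∸m≡n (suc (suc D)) j)) , e≡

  e≤1 : ∀ k → e k ≤ 1
  e≤1 k with k ≤? suc D
  ... | yes _ = z≤n
  ... | no  _ = ≤-refl

  e≡0⇒P≡id : ∀ k → e k ≡ 0 → P k ≡ k
  e≡0⇒P≡id k e≡0 with k ≤? suc D
  ... | yes _ = refl
  ... | no  _ with () ← e≡0

  Adjacent : ℕ → ℕ → Set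
  Adjacent k l = (e k ≡ 0 × e l ≡ 0 × Consecutive (P k) (P l)) ⊎ (P k ≡ P l × e k + e l ≡ 1)

  adjacent? : ∀ k l → Dec (Adjacent k l)
  adjacent? k l = (e k ℕ.≟ 0 ×-dec e l ℕ.≟ 0 ×-dec (suc (P k) ℕ.≟ P l ⊎-dec suc (P l) ℕ.≟ P k))
           ⊎-dec (P k ℕ.≟ P l ×-dec e k + e l ℕ.≟ 1)

  Adjacent-sym : ∀ k l → Adjacent k l → Adjacent l k
  Adjacent-sym k l (inj₁ (ek , el , inj₁ c)) = inj₁ (el , ek , inj₂ c)
  Adjacent-sym k l (inj₁ (ek , el , inj₂ c)) = inj₁ (el , ek , inj₁ c)
  Adjacent-sym k l (inj₂ (p , s))            = inj₂ (sym p , trans (+-comm (e l) (e k)) s)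

  Adjacent-irrefl : ∀ k → ¬ Adjacent k k
  Adjacent-irrefl k (inj₁ (_ , _ , inj₁ c)) = 1+n≢n c
  Adjacent-irrefl k (inj₁ (_ , _ , inj₂ c)) = 1+n≢n c
  Adjacent-irrefl k (inj₂ (_ , s)) with e k | e≤1 k
  ... | zero  | _ with () ← s
  ... | suc zero | _ with () ← s

  adjacent?-sym : ∀ k l → ⌊ adjacent? k l ⌋ ≡ ⌊ adjacent? l k ⌋
  adjacent?-sym k l = trans (isYes≗does (adjacent? k l))
    (trans (does-⇔ (mk⇔ (Adjacent-sym k l) (Adjacent-sym l k)) (adjacent? k l) (adjacent? l k)) (sym (isYes≗does (adjacent? l k))))

  adjacent?-irrefl : ∀ k → ⌊ adjacent? k k ⌋ ≡ false
  adjacent?-irrefl k = trans (isYes≗does (adjacent? k k)) (dec-false (adjacent? k k) (Adjacent-irrefl k))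

  G′ : Graph N
  G′ = record
    { adj    = λ x y → ⌊ adjacent? (toℕ x) (toℕ y) ⌋
    ; sym    = λ x y → adjacent?-sym (toℕ x) (toℕ y)
    ; irrefl = λ x → adjacent?-irrefl (toℕ x)
    }

  Adj⇒Adjacent : ∀ x y → Adj G′ x y → Adjacent (toℕ x) (toℕ y)
  Adj⇒Adjacent x y xy = toWitness {a? = adjacent? (toℕ x) (toℕ y)} (from T-≡ xy)

  Adjacent⇒Adj : ∀ x y → Adjacent (toℕ x) (toℕ y) → Adj G′ x y
  Adjacent⇒Adj x y a = to T-≡ (fromWitness {a? = adjacent? (toℕ x) (toℕ y)} a)

  e≡0⇒≤1+D : ∀ k → e k ≡ 0 → k ≤ suc D
  e≡0⇒≤1+D k e≡0 with k ≤? suc D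
  ... | yes k≤ = k≤
  ... | no  _ with () ← e≡0

  e≡1⇒foot : ∀ k → e k ≡ 1 → 1 ≤ P k × P k ≤ D
  e≡1⇒foot k e≡1 with k ≤? suc D
  ... | yes _ with () ← e≡1
  ... | no  _ = 1≤foot (k ∸ suc (suc D)) , foot≤D (k ∸ suc (suc D))

  on-path-neighbour : ∀ k l → e k ≡ 0 → Adjacent k l → (e l ≡ 0 × Consecutive k l) ⊎ (e l ≡ 1 × P l ≡ k)
  on-path-neighbour k l ek≡0 (inj₁ (_ , el≡0 , c)) =
    inj₁ (el≡0 , subst₂ Consecutive (e≡0⇒P≡id k ek≡0) (e≡0⇒P≡id l el≡0) c)
  on-path-neighbour k l ek≡0 (inj₂ (Pk≡Pl , s)) =
    inj₂ (trans (sym (cong (_+ e l) ek≡0)) s , trans (sym Pk≡Pl) (e≡0⇒P≡id k ek≡0))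

  off-path-neighbour : ∀ k l → e k ≡ 1 → Adjacent k l → l ≡ P k
  off-path-neighbour k l ek≡1 (inj₁ (ek≡0 , _)) with () ← trans (sym ek≡1) ek≡0
  off-path-neighbour k l ek≡1 (inj₂ (Pk≡Pl , s)) = trans (sym (e≡0⇒P≡id l el≡0)) (sym Pk≡Pl)
    where
    el≡0 : e l ≡ 0
    el≡0 = +-cancelˡ-≡ 1 (e l) 0 (trans (cong (_+ e l) (sym ek≡1)) s)

  left-end-neighbour : ∀ l → Adjacent 0 l → l ≡ 1
  left-end-neighbour l adj with on-path-neighbour 0 l refl adj
  ... | inj₁ (_ , inj₁ 1≡l)  = sym 1≡l
  ... | inj₂ (el≡1 , Pl≡0) = ⊥-elim (<⇒≢ (proj₁ (e≡1⇒foot l el≡1)) (sym Pl≡0))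

  right-end-neighbour : ∀ l → Adjacent (suc D) l → l ≡ D
  right-end-neighbour l adj with on-path-neighbour (suc D) l (proj₂ (coords-path {suc D} ≤-refl)) adj
  ... | inj₁ (el≡0 , inj₁ 2+D≡l) = ⊥-elim (<⇒≱ (≤-reflexive 2+D≡l) (e≡0⇒≤1+D l el≡0))
  ... | inj₁ (_ , inj₂ 1+l≡1+D)  = suc-injective 1+l≡1+D
  ... | inj₂ (el≡1 , Pl≡1+D)     = ⊥-elim (<⇒≱ (s≤s (proj₂ (e≡1⇒foot l el≡1))) (≤-reflexive (sym Pl≡1+D)))

  ≤1+D⇒<N : ∀ {k} → k ≤ suc D → k < N
  ≤1+D⇒<N k≤ = s≤s (≤-trans k≤ (m≤m+n (suc D) L))

  spine′ : Fin D → Fin N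
  spine′ i = fromℕ< (≤1+D⇒<N (s≤s (<⇒≤ (Finₚ.toℕ<n i))))

  toℕ-spine′ : ∀ i → toℕ (spine′ i) ≡ suc (toℕ i)
  toℕ-spine′ i = Finₚ.toℕ-fromℕ< (≤1+D⇒<N (s≤s (<⇒≤ (Finₚ.toℕ<n i))))

  spine-at : ∀ p → 1 ≤ p → p ≤ D → Fin D
  spine-at (suc p) _ p<D = fromℕ< p<D

  toℕ-spine-at : ∀ p 1≤p p≤D → toℕ (spine′ (spine-at p 1≤p p≤D)) ≡ p
  toℕ-spine-at (suc p) 1≤p p<D = trans (toℕ-spine′ _) (cong suc (Finₚ.toℕ-fromℕ< p<D))

  spine-path : ∀ i → P (toℕ (spine′ i)) ≡ toℕ (spine′ i) × e (toℕ (spine′ i)) ≡ 0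
  spine-path i = coords-path (≤-trans (≤-reflexive (toℕ-spine′ i)) (s≤s (<⇒≤ (Finₚ.toℕ<n i))))

  data Kind (k : ℕ) : Set where
    left-end  : k ≡ 0 → Kind k
    inner     : 1 ≤ k → k ≤ D → Kind k
    right-end : k ≡ suc D → Kind k
    leaf      : suc (suc D) ≤ k → Kind k

  kind : ∀ k → Kind k
  kind zero = left-end refl
  kind (suc k) with suc k ≤? D | suc k ℕ.≟ suc D
  ... | yes k<D | _         = inner (s≤s z≤n) k<D
  ... | no  _   | yes k≡D   = right-end k≡D
  ... | no  k≮D | no  k≢D   = leaf (≤∧≢⇒< (≰⇒> k≮D) (k≢D ∘ sym))

  off-spine : ∀ x → ¬ (1 ≤ toℕ x × toℕ x ≤ D) → ∀ j → spine′ j ≢ x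
  off-spine x not-inner j refl = not-inner (subst (λ k → 1 ≤ k × k ≤ D) (sym (toℕ-spine′ j)) (s≤s z≤n , Finₚ.toℕ<n j))

  pendant-at : ∀ x p (1≤p : 1 ≤ p) (p≤D : p ≤ D) → Adjacent (toℕ x) p → (∀ l → Adjacent (toℕ x) l → l ≡ p) →
               PendantAt G′ x (spine′ (spine-at p 1≤p p≤D))
  pendant-at x p 1≤p p≤D adj only = Adjacent⇒Adj x (spine′ (spine-at p 1≤p p≤D)) (subst (Adjacent (toℕ x)) (sym (toℕ-spine-at p 1≤p p≤D)) adj) ,
    λ y xy → Finₚ.toℕ-injective (trans (only (toℕ y) (Adj⇒Adjacent x y xy)) (sym (toℕ-spine-at p 1≤p p≤D)))

  locateAt : ∀ x → Kind (toℕ x) → Located G′ spine′ x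
  locateAt x (left-end x≡0) = inj₂ (spine-at 1 ≤-refl 1≤D ,
    pendant-at x 1 ≤-refl 1≤D (subst (λ k → Adjacent k 1) (sym x≡0) (inj₁ (refl , proj₂ (coords-path (s≤s z≤n)) , inj₁ (sym (proj₁ (coords-path (s≤s z≤n)))))))
      (λ l adj → left-end-neighbour l (subst (λ k → Adjacent k l) x≡0 adj)) ,
    off-spine x (λ (1≤x , _) → <⇒≢ 1≤x (sym x≡0)))
  locateAt x (inner 1≤x x≤D) = inj₁ (spine-at (toℕ x) 1≤x x≤D , Finₚ.toℕ-injective (toℕ-spine-at (toℕ x) 1≤x x≤D))
  locateAt x (right-end x≡1+D) = inj₂ (spine-at D 1≤D ≤-refl ,
    pendant-at x D 1≤D ≤-refl (subst (λ k → Adjacent k D) (sym x≡1+D) right-end-adjacent)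
      (λ l adj → right-end-neighbour l (subst (λ k → Adjacent k l) x≡1+D adj)) ,
    off-spine x (λ (_ , x≤D) → <⇒≱ (≤-reflexive (sym x≡1+D)) x≤D))
    where
    right-end-adjacent : Adjacent (suc D) D
    right-end-adjacent = inj₁ (proj₂ (coords-path ≤-refl) , proj₂ (coords-path (n≤1+n D)) ,
      inj₂ (trans (cong suc (proj₁ (coords-path (n≤1+n D)))) (sym (proj₁ (coords-path ≤-refl)))))
  locateAt x (leaf x≥) = inj₂ (spine-at (P (toℕ x)) 1≤Px Px≤D ,
    pendant-at x (P (toℕ x)) 1≤Px Px≤D leaf-adjacent (λ l → off-path-neighbour (toℕ x) l ex≡1) ,
    off-spine x (λ (_ , x≤D) → <-irrefl refl (≤-<-trans x≤D (<-≤-trans (m<n⇒m<1+n (n<1+n D)) x≥))))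
    where
    ex≡1 = proj₂ (coords-off-path x≥)
    1≤Px = proj₁ (e≡1⇒foot (toℕ x) ex≡1)
    Px≤D = proj₂ (e≡1⇒foot (toℕ x) ex≡1)
    foot-path = coords-path (≤-trans Px≤D (n≤1+n D))
    leaf-adjacent : Adjacent (toℕ x) (P (toℕ x))
    leaf-adjacent = inj₂ (sym (proj₁ foot-path) , trans (cong₂ _+_ ex≡1 (proj₂ foot-path)) refl)

  C′ : Caterpillar G′
  C′ = record
    { m = D ; spine = spine′ ; spine-injective = spine-injective
    ; spine-adj = λ i j i+1≡j → Adjacent⇒Adj (spine′ i) (spine′ j)
        (inj₁ (proj₂ (spine-path i) , proj₂ (spine-path j) , inj₁ (subst₂ (λ p q → suc p ≡ q) (sym (P-spine i)) (sym (P-spine j))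
          (trans (cong suc (toℕ-spine′ i)) (trans (cong suc i+1≡j) (sym (toℕ-spine′ j)))))))
    ; spine-adj⁻ = spine-adj⁻
    ; locate = λ x → locateAt x (kind (toℕ x)) }
    where
    P-spine : ∀ i → P (toℕ (spine′ i)) ≡ toℕ (spine′ i)
    P-spine i = proj₁ (spine-path i)
    spine-injective : ∀ {i j} → spine′ i ≡ spine′ j → i ≡ j
    spine-injective {i} {j} e = Finₚ.toℕ-injective (suc-injective (trans (sym (toℕ-spine′ i)) (trans (cong toℕ e) (toℕ-spine′ j))))
    spine-adj⁻ : ∀ i j → Adj G′ (spine′ i) (spine′ j) → Consecutive (toℕ i) (toℕ j)
    spine-adj⁻ i j ij with on-path-neighbour _ _ (proj₂ (spine-path i)) (Adj⇒Adjacent (spine′ i) (spine′ j) ij)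
    ... | inj₂ (ej≡1 , _) with () ← trans (sym ej≡1) (proj₂ (spine-path j))
    ... | inj₁ (_ , c) with subst₂ Consecutive (toℕ-spine′ i) (toℕ-spine′ j) c
    ...   | inj₁ e = inj₁ (suc-injective e)
    ...   | inj₂ e = inj₂ (suc-injective e)

  open CaterpillarMetric C′ using (anchorOf; heightOf; pos; height; δ)

  suc-toℕ-spine-at : ∀ p 1≤p p≤D → suc (toℕ (spine-at p 1≤p p≤D)) ≡ p
  suc-toℕ-spine-at p 1≤p p≤D = trans (sym (toℕ-spine′ _)) (toℕ-spine-at p 1≤p p≤D)

  data Placed (x : Fin N) (p h : ℕ) : Set where
    at-left-end  : toℕ x ≡ 0 → p ≡ 1 → h ≡ 1 → Placed x p h
    at-right-end : toℕ x ≡ suc D → p ≡ D → h ≡ 1 → Placed x p h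
    elsewhere    : p ≡ P (toℕ x) → h ≡ e (toℕ x) → Placed x p h

  placed : ∀ x → Placed x (suc (pos x)) (height x)
  placed x = go (kind (toℕ x))
    where
    go : (k : Kind (toℕ x)) → Placed x (suc (toℕ (anchorOf (locateAt x k)))) (heightOf (locateAt x k))
    go (left-end x≡0)    = at-left-end x≡0 (suc-toℕ-spine-at 1 ≤-refl 1≤D) refl
    go (inner 1≤x x≤D)   = elsewhere (trans (suc-toℕ-spine-at _ 1≤x x≤D) (sym (proj₁ (coords-path (≤-trans x≤D (n≤1+n D))))))
                                     (sym (proj₂ (coords-path (≤-trans x≤D (n≤1+n D)))))
    go (right-end x≡1+D) = at-right-end x≡1+D (suc-toℕ-spine-at D 1≤D ≤-refl) refl
    go (leaf x≥)         = elsewhere (suc-toℕ-spine-at _ _ _) (sym (proj₂ (coords-off-path x≥)))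

  a′ b′ : Fin N
  a′ = fromℕ< (≤1+D⇒<N z≤n)
  b′ = fromℕ< (≤1+D⇒<N ≤-refl)

  toℕ-a′ : toℕ a′ ≡ 0
  toℕ-a′ = Finₚ.toℕ-fromℕ< (≤1+D⇒<N z≤n)

  toℕ-b′ : toℕ b′ ≡ suc D
  toℕ-b′ = Finₚ.toℕ-fromℕ< (≤1+D⇒<N ≤-refl)

  E′ : Ends C′
  E′ = record
    { a = a′ ; b = b′ ; a≢b = λ a≡b → 1+n≢0 (trans (sym toℕ-b′) (trans (cong toℕ (sym a≡b)) toℕ-a′))
    ; height-a = proj₂ a-end ; height-b = proj₂ b-end
    ; pos-a = suc-injective (proj₁ a-end) ; pos-b = proj₁ b-end }
    where
    a-end : suc (pos a′) ≡ 1 × height a′ ≡ 1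
    a-end with placed a′
    ... | at-left-end _ p≡ h≡ = p≡ , h≡
    ... | at-right-end a≡ _ _ with () ← trans (sym toℕ-a′) a≡
    ... | elsewhere p≡ _ with () ← trans p≡ (trans (cong P toℕ-a′) (proj₁ (coords-path z≤n)))
    b-end : suc (pos b′) ≡ D × height b′ ≡ 1
    b-end with placed b′
    ... | at-left-end b≡ _ _ with () ← trans (sym toℕ-b′) b≡
    ... | at-right-end _ p≡ h≡ = p≡ , h≡
    ... | elsewhere p≡ _ = ⊥-elim (<-irrefl (suc-injective (trans p≡ (trans (cong P toℕ-b′) (proj₁ (coords-path ≤-refl)))))
                                        (Finₚ.toℕ<n (CaterpillarMetric.anchor C′ b′)))

  open LongPath E′ using (EndView; is-a; is-b; inner; endView; pathPosOf; offPathOf; pathPos; offPath; long-path-δ; diam≡1+m)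

  N-large : suc D ≤ N
  N-large = <⇒≤ (≤1+D⇒<N ≤-refl)

  coords-G′ : ∀ x → pathPos x ≡ P (toℕ x) × offPath x ≡ e (toℕ x)
  coords-G′ x = go (endView x)
    where
    go : (v : EndView x) → pathPosOf v ≡ P (toℕ x) × offPathOf v ≡ e (toℕ x)
    go (is-a refl) = let P≡ , e≡ = coords-path z≤n in
      sym (trans (cong P toℕ-a′) P≡) , sym (trans (cong e toℕ-a′) e≡)
    go (is-b refl) = let P≡ , e≡ = coords-path ≤-refl in
      sym (trans (cong P toℕ-b′) P≡) , sym (trans (cong e toℕ-b′) e≡)
    go (inner x≢a x≢b) with placed x
    ... | at-left-end x≡0 _ _    = ⊥-elim (x≢a (Finₚ.toℕ-injective (trans x≡0 (sym toℕ-a′))))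
    ... | at-right-end x≡1+D _ _ = ⊥-elim (x≢b (Finₚ.toℕ-injective (trans x≡1+D (sym toℕ-b′))))
    ... | elsewhere p≡ h≡        = p≡ , h≡

  dist-G′ : ∀ {x y} → x ≢ y → dist G′ x y ≡ ∣ P (toℕ x) - P (toℕ y) ∣ + e (toℕ x) + e (toℕ y)
  dist-G′ {x} {y} x≢y = begin
    dist G′ x y                                            ≡⟨ CaterpillarMetric.dist≡δ C′ N-large x y ⟩
    δ x y                                                  ≡⟨ long-path-δ x≢y ⟩
    ∣ pathPos x - pathPos y ∣ + offPath x + offPath y      ≡⟨ cong₂ (λ p q → ∣ p - q ∣ + offPath x + offPath y) (proj₁ (coords-G′ x)) (proj₁ (coords-G′ y)) ⟩
    ∣ P (toℕ x) - P (toℕ y) ∣ + offPath x + offPath y      ≡⟨ cong₂ (λ o o′ → ∣ P (toℕ x) - P (toℕ y) ∣ + o + o′) (proj₂ (coords-G′ x)) (proj₂ (coords-G′ y)) ⟩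
    ∣ P (toℕ x) - P (toℕ y) ∣ + e (toℕ x) + e (toℕ y)      ∎
    where open ≡-Reasoning

  diam-G′ : diam G′ ≡ suc D
  diam-G′ = diam≡1+m N-large

  isCaterpillar-G′ : IsCaterpillar G′
  isCaterpillar-G′ = caterpillar⇒IsCaterpillar C′ two-neighbours
    where
    two-neighbours : ∀ i → 2 ≤ deg G′ (spine′ i)
    two-neighbours i = ≤-trans (count-≥2 (adj G′ (spine′ i)) {below} {above}
        (Adjacent⇒Adj (spine′ i) below (inj₁ (proj₂ (spine-path i) , e-below , inj₂ (trans (cong suc P-below) (sym P-spine)))))
        (Adjacent⇒Adj (spine′ i) above (inj₁ (proj₂ (spine-path i) , e-above , inj₁ (trans (cong suc P-spine) (sym P-above)))))
        below≢above)
      (≤-reflexive (sym (deg-count G′ (spine′ i))))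
      where
      i<D = Finₚ.toℕ<n i
      below above : Fin N
      below = fromℕ< (≤1+D⇒<N (≤-trans (<⇒≤ i<D) (n≤1+n D)))
      above = fromℕ< (≤1+D⇒<N (s≤s i<D))
      toℕ-below : toℕ below ≡ toℕ i
      toℕ-below = Finₚ.toℕ-fromℕ< (≤1+D⇒<N (≤-trans (<⇒≤ i<D) (n≤1+n D)))
      toℕ-above : toℕ above ≡ suc (suc (toℕ i))
      toℕ-above = Finₚ.toℕ-fromℕ< (≤1+D⇒<N (s≤s i<D))
      P-spine : P (toℕ (spine′ i)) ≡ suc (toℕ i)
      P-spine = trans (proj₁ (spine-path i)) (toℕ-spine′ i)
      below-path = coords-path (subst (_≤ suc D) (sym toℕ-below) (≤-trans (<⇒≤ i<D) (n≤1+n D)))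
      above-path = coords-path (subst (_≤ suc D) (sym toℕ-above) (s≤s i<D))
      P-below : P (toℕ below) ≡ toℕ i
      P-below = trans (proj₁ below-path) toℕ-below
      P-above : P (toℕ above) ≡ suc (suc (toℕ i))
      P-above = trans (proj₁ above-path) toℕ-above
      e-below = proj₂ below-path
      e-above = proj₂ above-path
      below≢above : below ≢ above
      below≢above b≡a = <⇒≢ (m<n⇒m<1+n (n<1+n (toℕ i))) (trans (sym toℕ-below) (trans (cong toℕ b≡a) toℕ-above))

  ∑-vertices : ∀ (F : ℕ → ℕ → ℕ) →
    ∑[ y < N ] F (P (toℕ y)) (e (toℕ y)) ≡ ∑[ l < suc (suc D) ] F (toℕ l) 0 + ∑[ j < L ] F (foot (toℕ j)) 1
  ∑-vertices F = trans (∑-++ (suc (suc D)) (λ y → F (P (toℕ y)) (e (toℕ y))))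
    (cong₂ _+_ (sum-cong-≗ on-path) (sum-cong-≗ off-path))
    where
    on-path : ∀ (l : Fin (suc (suc D))) → F (P (toℕ (l ↑ˡ L))) (e (toℕ (l ↑ˡ L))) ≡ F (toℕ l) 0
    on-path l = let toℕ≡ = Finₚ.toℕ-↑ˡ l L
                    P≡ , e≡ = coords-path (subst (_≤ suc D) (sym toℕ≡) (s≤s⁻¹ (Finₚ.toℕ<n l)))
                in cong₂ F (trans P≡ toℕ≡) e≡
    off-path : ∀ (j : Fin L) → F (P (toℕ (suc (suc D) ↑ʳ j))) (e (toℕ (suc (suc D) ↑ʳ j))) ≡ F (foot (toℕ j)) 1
    off-path j = let toℕ≡ = Finₚ.toℕ-↑ʳ (suc (suc D)) j in
      cong₂ F (trans (cong P toℕ≡) (proj₁ (coords-leaf (toℕ j)))) (trans (cong e toℕ≡) (proj₂ (coords-leaf (toℕ j))))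

  leaves-bound : ∀ c o → o ≤ 1 → (g : ℕ → ℕ) → (∀ j → g j ≤ c + r * ∣ o - j % 2 ∣) →
                 (∑[ j < L ] g (toℕ j)) * 2 ≤ c * L * 2 + r * suc L
  leaves-bound c o o≤1 g g≤ = begin
    (∑[ j < L ] g (toℕ j)) * 2                                   ≤⟨ *-monoˡ-≤ 2 (∑-mono-≤ {L} {g ∘ toℕ} {λ j → c + r * ∣ o - toℕ j % 2 ∣} (g≤ ∘ toℕ)) ⟩
    (∑[ j < L ] (c + r * ∣ o - toℕ j % 2 ∣)) * 2                 ≡⟨ cong (_* 2) (∑-distrib-+ {L} (λ _ → c) (λ j → r * ∣ o - toℕ j % 2 ∣)) ⟩
    (∑[ j < L ] c + ∑[ j < L ] (r * ∣ o - toℕ j % 2 ∣)) * 2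
      ≡⟨ cong₂ (λ u v → (u + v) * 2) (trans (∑-const L c) (*-comm L c)) (sym (*-distribˡ-sum {L} r (λ j → ∣ o - toℕ j % 2 ∣))) ⟩
    (c * L + r * X) * 2                                          ≡⟨ *-distribʳ-+ 2 (c * L) (r * X) ⟩
    c * L * 2 + r * X * 2                                        ≡⟨ cong (c * L * 2 +_) (*-assoc r X 2) ⟩
    c * L * 2 + r * (X * 2)                                      ≤⟨ +-monoʳ-≤ (c * L * 2) (*-monoʳ-≤ r (∑-alternating o o≤1 L)) ⟩
    c * L * 2 + r * suc L                                        ∎
    where
    open ≤-Reasoning
    X = ∑[ j < L ] ∣ o - toℕ j % 2 ∣

  ∣1-o∣+o≡1 : ∀ {o} → o ≤ 1 → ∣ 1 - o ∣ + o ≡ 1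
  ∣1-o∣+o≡1 z≤n       = refl
  ∣1-o∣+o≡1 (s≤s z≤n) = refl

  feet-split : ∀ {o} → o ≤ 1 → h + r * o + (h + r * ∣ 1 - o ∣) ≡ suc D
  feet-split {o} o≤1 = begin
    h + r * o + (h + r * ∣ 1 - o ∣) ≡⟨ solve 4 (λ h r o p → h :+ r :* o :+ (h :+ r :* p) := h :+ h :+ r :* (p :+ o)) refl h r o ∣ 1 - o ∣ ⟩
    h + h + r * (∣ 1 - o ∣ + o)     ≡⟨ cong (λ k → h + h + r * k) (∣1-o∣+o≡1 o≤1) ⟩
    h + h + r * 1                   ≡⟨ cong (h + h +_) (*-identityʳ r) ⟩
    h + h + r                       ≡⟨ h+h+r≡1+D ⟩
    suc D                           ∎
    where open ≡-Reasoning

  path-to-leaf : ∀ {q} → q ≤ suc D → Σ ℕ λ o → o ≤ 1 × (∀ j → ∣ q - foot j ∣ ≤ h + r * ∣ o - j % 2 ∣)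
  path-to-leaf {q} q≤1+D with q ≤? h
  ... | yes q≤h = 0 , z≤n , λ j → ∣-∣≤ (≤-trans q≤h (≤-trans (m≤m+n h _) (m≤m+n _ _))) (m≤n+m _ q)
  ... | no  q≰h = 1 , s≤s z≤n , λ j → ∣-∣≤
    (≤-trans q≤1+D (≤-reflexive (sym (feet-split {j % 2} (%2≤1 j)))))
    (≤-trans (+-monoʳ-≤ h (r*o≤r (%2≤1 j))) (≤-trans (+-monoʳ-≤ h r≤1) (≤-trans (≤-reflexive (+-comm h 1)) (≤-trans (≰⇒> q≰h) (m≤m+n q _)))))

  leaf-to-leaf : ∀ i j → ∣ foot i - foot j ∣ ≤ 0 + r * ∣ i % 2 - j % 2 ∣
  leaf-to-leaf i j = ≤-reflexive (trans (∣m+n-m+o∣≡∣n-o∣ h (r * (i % 2)) (r * (j % 2))) (sym (*-distribˡ-∣-∣ r (i % 2) (j % 2))))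

  ∑-path-distances : ∀ q s → q + s ≡ suc D → (∑[ l < suc (suc D) ] ∣ q - toℕ l ∣) * 2 ≡ q * suc q + s * suc s
  ∑-path-distances q s q+s≡1+D = trans (cong (λ k → (∑[ l < suc k ] ∣ q - toℕ l ∣) * 2) (sym q+s≡1+D)) (gauss q s)

  transmission-on-path-≤ : ∀ x → toℕ x ≤ suc D →
    transmission G′ x ≤ ∑[ l < suc (suc D) ] ∣ toℕ x - toℕ l ∣ + (∑[ j < L ] ∣ toℕ x - foot (toℕ j) ∣ + L)
  transmission-on-path-≤ x q≤1+D = begin
    transmission G′ x                                 ≡⟨ transmission-∑ G′ x ⟩
    sum (dist G′ x)                                   ≤⟨ ∑-mono-≤ dist≤ ⟩
    ∑[ y < N ] (∣ q - P (toℕ y) ∣ + e (toℕ y))       ≡⟨ ∑-vertices (λ p o → ∣ q - p ∣ + o) ⟩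
    ∑[ l < suc (suc D) ] (∣ q - toℕ l ∣ + 0) + ∑[ j < L ] (∣ q - foot (toℕ j) ∣ + 1)
      ≡⟨ cong₂ _+_ (sum-cong-≗ {suc (suc D)} {λ l → ∣ q - toℕ l ∣ + 0} {λ l → ∣ q - toℕ l ∣} (λ l → +-identityʳ _))
                   (∑-distrib-+ {L} (λ j → ∣ q - foot (toℕ j) ∣) (λ _ → 1)) ⟩
    ∑[ l < suc (suc D) ] ∣ q - toℕ l ∣ + (∑[ j < L ] ∣ q - foot (toℕ j) ∣ + ∑[ j < L ] 1)
      ≡⟨ cong (λ k → ∑[ l < suc (suc D) ] ∣ q - toℕ l ∣ + (∑[ j < L ] ∣ q - foot (toℕ j) ∣ + k)) (trans (∑-const L 1) (*-identityʳ L)) ⟩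
    ∑[ l < suc (suc D) ] ∣ q - toℕ l ∣ + (∑[ j < L ] ∣ q - foot (toℕ j) ∣ + L) ∎
    where
    open ≤-Reasoning
    q = toℕ x
    dist≤ : ∀ y → dist G′ x y ≤ ∣ q - P (toℕ y) ∣ + e (toℕ y)
    dist≤ y = go (x Fin.≟ y)
      where
      go : Dec (x ≡ y) → dist G′ x y ≤ ∣ q - P (toℕ y) ∣ + e (toℕ y)
      go (yes refl) = ≤-trans (dist-≤ G′ {x} here) z≤n
      go (no x≢y)   = ≤-reflexive (trans (dist-G′ x≢y)
                        (trans (cong₂ (λ p o → ∣ p - P (toℕ y) ∣ + o + e (toℕ y)) (proj₁ (coords-path q≤1+D)) (proj₂ (coords-path q≤1+D)))
                               (cong (_+ e (toℕ y)) (+-identityʳ _))))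

  transmission-on-path : ∀ x → toℕ x ≤ suc D → transmission G′ x * 2 + (D * 2 + 3) ≤ (D + 3) * N
  transmission-on-path x q≤1+D = begin
    T′ * 2 + (D * 2 + 3)                                              ≤⟨ +-monoˡ-≤ _ (*-monoˡ-≤ 2 (transmission-on-path-≤ x q≤1+D)) ⟩
    (A + (Y + L)) * 2 + (D * 2 + 3)
      ≡⟨ cong (_+ (D * 2 + 3)) (solve 3 (λ A Y L → (A :+ (Y :+ L)) :* con 2 := A :* con 2 :+ Y :* con 2 :+ L :* con 2) refl A Y L) ⟩
    A * 2 + Y * 2 + L * 2 + (D * 2 + 3)                              ≤⟨ +-monoˡ-≤ _ (+-monoˡ-≤ _ (+-mono-≤ 2A≤ (leaves-bound h o o≤1 (λ j → ∣ q - foot j ∣) q-to-leaf))) ⟩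
    suc D * suc (suc D) + (h * L * 2 + r * suc L) + L * 2 + (D * 2 + 3) ≤⟨ path-vertex-polynomial h r D L h+h+r≡1+D r≤1 ⟩
    (D + 3) * N                                                      ∎
    where
    open ≤-Reasoning
    q = toℕ x
    T′ = transmission G′ x
    A = ∑[ l < suc (suc D) ] ∣ q - toℕ l ∣
    Y = ∑[ j < L ] ∣ q - foot (toℕ j) ∣
    o = proj₁ (path-to-leaf q≤1+D)
    o≤1 = proj₁ (proj₂ (path-to-leaf q≤1+D))
    q-to-leaf = proj₂ (proj₂ (path-to-leaf q≤1+D))
    q+s≡1+D = m+[n∸m]≡n q≤1+D
    2A≤ : A * 2 ≤ suc D * suc (suc D)
    2A≤ = ≤-trans (≤-reflexive (∑-path-distances q (suc D ∸ q) q+s≡1+D))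
                  (≤-trans (sq+sq≤ q (suc D ∸ q)) (≤-reflexive (cong (λ k → k * suc k) q+s≡1+D)))

  transmission-off-path-≤ : ∀ x → suc (suc D) ≤ toℕ x → let q = foot (toℕ x ∸ suc (suc D)) in
    transmission G′ x + 2 ≤ ∑[ l < suc (suc D) ] ∣ q - toℕ l ∣ + suc (suc D) + (∑[ j < L ] ∣ q - foot (toℕ j) ∣ + L * 2)
  transmission-off-path-≤ x k≥ = begin
    transmission G′ x + 2                             ≡⟨ cong (_+ 2) (transmission-∑ G′ x) ⟩
    sum (dist G′ x) + 2                               ≤⟨ ∑-mono-≤-+ x dist≤ x-term ⟩
    sum B                                             ≡⟨ ∑-vertices (λ p o → ∣ q - p ∣ + 1 + o) ⟩
    ∑[ l < suc (suc D) ] (∣ q - toℕ l ∣ + 1 + 0) + ∑[ j < L ] (∣ q - foot (toℕ j) ∣ + 1 + 1)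
      ≡⟨ cong₂ _+_ (trans (sum-cong-≗ {suc (suc D)} {λ l → ∣ q - toℕ l ∣ + 1 + 0} {λ l → ∣ q - toℕ l ∣ + 1} (λ l → +-identityʳ _))
                          (∑-distrib-+ {suc (suc D)} (λ l → ∣ q - toℕ l ∣) (λ _ → 1)))
                   (trans (sum-cong-≗ {L} {λ j → ∣ q - foot (toℕ j) ∣ + 1 + 1} {λ j → ∣ q - foot (toℕ j) ∣ + 2} (λ j → +-assoc _ 1 1))
                          (∑-distrib-+ {L} (λ j → ∣ q - foot (toℕ j) ∣) (λ _ → 2))) ⟩
    A + ∑[ l < suc (suc D) ] 1 + (Y + ∑[ j < L ] 2)    ≡⟨ cong₂ (λ u v → A + u + (Y + v)) (trans (∑-const (suc (suc D)) 1) (*-identityʳ _)) (∑-const L 2) ⟩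
    A + suc (suc D) + (Y + L * 2)                     ∎
    where
    open ≤-Reasoning
    q = foot (toℕ x ∸ suc (suc D))
    A = ∑[ l < suc (suc D) ] ∣ q - toℕ l ∣
    Y = ∑[ j < L ] ∣ q - foot (toℕ j) ∣
    Pk = proj₁ (coords-off-path k≥)
    ek = proj₂ (coords-off-path k≥)
    B : Fin N → ℕ
    B y = ∣ q - P (toℕ y) ∣ + 1 + e (toℕ y)
    dist≤ : ∀ y → x ≢ y → dist G′ x y ≤ B y
    dist≤ y x≢y = ≤-reflexive (trans (dist-G′ x≢y) (cong₂ (λ p o → ∣ p - P (toℕ y) ∣ + o + e (toℕ y)) Pk ek))
    x-term : dist G′ x x + 2 ≤ B x
    x-term = ≤-trans (+-monoˡ-≤ 2 (dist-≤ G′ {x} here))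
               (≤-reflexive (sym (trans (cong₂ (λ p o → ∣ q - p ∣ + 1 + o) Pk ek) (cong (λ d → d + 1 + 1) (∣n-n∣≡0 q)))))

  transmission-off-path : ∀ x → suc (suc D) ≤ toℕ x → transmission G′ x * 2 + (D * 2 + 3) ≤ (D + 3) * N
  transmission-off-path x k≥ = +-cancelʳ-≤ 4 _ _ (begin
    T′ * 2 + (D * 2 + 3) + 4                               ≡⟨ solve 2 (λ T′ E → T′ :* con 2 :+ E :+ con 4 := (T′ :+ con 2) :* con 2 :+ E) refl T′ (D * 2 + 3) ⟩
    (T′ + 2) * 2 + (D * 2 + 3)                             ≤⟨ +-monoˡ-≤ _ (*-monoˡ-≤ 2 (transmission-off-path-≤ x k≥)) ⟩
    (A + suc (suc D) + (Y + L * 2)) * 2 + (D * 2 + 3)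
      ≡⟨ cong (_+ (D * 2 + 3)) (solve 4 (λ A S Y L → (A :+ S :+ (Y :+ L :* con 2)) :* con 2
                                                      := A :* con 2 :+ S :* con 2 :+ Y :* con 2 :+ L :* con 4) refl A (suc (suc D)) Y L) ⟩
    A * 2 + suc (suc D) * 2 + Y * 2 + L * 4 + (D * 2 + 3)
      ≤⟨ +-monoˡ-≤ _ (+-monoˡ-≤ _ (+-mono-≤ (≤-reflexive (cong (_+ suc (suc D) * 2) (∑-path-distances q s (feet-split o≤1))))
                                            (leaves-bound 0 o o≤1 (λ j → ∣ q - foot j ∣) (leaf-to-leaf j₀)))) ⟩
    q * suc q + s * suc s + suc (suc D) * 2 + (0 * L * 2 + r * suc L) + L * 4 + (D * 2 + 3)
      ≤⟨ leaf-polynomial h r o D L h+h+r≡1+D 1≤h r≤1 o≤1 ⟩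
    (D + 3) * N + 4                                        ∎)
    where
    open ≤-Reasoning
    j₀ = toℕ x ∸ suc (suc D)
    o = j₀ % 2
    o≤1 = %2≤1 j₀
    q = foot j₀
    s = h + r * ∣ 1 - o ∣
    T′ = transmission G′ x
    A = ∑[ l < suc (suc D) ] ∣ q - toℕ l ∣
    Y = ∑[ j < L ] ∣ q - foot (toℕ j) ∣

  transmission-G′ : ∀ x → transmission G′ x * 2 + (D * 2 + 3) ≤ (D + 3) * N
  transmission-G′ x = go (toℕ x ≤? suc D)
    where
    go : Dec (toℕ x ≤ suc D) → transmission G′ x * 2 + (D * 2 + 3) ≤ (D + 3) * N
    go (yes x≤1+D) = transmission-on-path x x≤1+D
    go (no  x≰1+D) = transmission-off-path x (≰⇒> x≰1+D)

  remoteness-G′ : ∀ ρ Ta Tb → normalize N Ta ℚ.≤ ρ → normalize N Tb ℚ.≤ ρ → 0ℚ ℚ.≤ ρ →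
                  suc (suc D) * N ≤ Ta + Tb + suc D * 2 → remoteness G′ ℚ.≤ ρ ℚ.+ ½
  remoteness-G′ ρ Ta Tb πa≤ρ πb≤ρ 0≤ρ ends = remoteness-≤ G′ 0≤ρ+½ bound
    where
    twice : ∀ t → t + t ≡ t * 2
    twice t = solve 1 (λ t → t :+ t := t :* con 2) refl t
    0≤ρ+½ : 0ℚ ℚ.≤ ρ ℚ.+ ½
    0≤ρ+½ = ℚₚ.≤-trans 0≤ρ (ℚₚ.≤-trans (ℚₚ.≤-reflexive (sym (ℚₚ.+-identityʳ ρ))) (ℚₚ.+-monoʳ-≤ ρ (ℚ.*≤* (+≤+ z≤n))))
    larger : Σ ℕ λ M → normalize N M ℚ.≤ ρ × Ta + Tb ≤ M * 2
    larger with ≤-total Tb Ta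
    ... | inj₁ Tb≤Ta = Ta , πa≤ρ , ≤-trans (+-monoʳ-≤ Ta Tb≤Ta) (≤-reflexive (twice Ta))
    ... | inj₂ Ta≤Tb = Tb , πb≤ρ , ≤-trans (+-monoˡ-≤ Tb Ta≤Tb) (≤-reflexive (twice Tb))
    M = proj₁ larger
    bound : ∀ x → π G′ x ℚ.≤ ρ ℚ.+ ½
    bound x = ℚₚ.≤-trans (/-≤-/+½ (D + L) T′ M 2T′≤) (ℚₚ.+-monoˡ-≤ ½ (proj₁ (proj₂ larger)))
      where
      T′ = transmission G′ x
      2T′≤ : T′ * 2 ≤ M * 2 + suc (D + L)
      2T′≤ = +-cancelʳ-≤ (D * 2 + 3 + suc (suc D) * N) (T′ * 2) (M * 2 + suc (D + L)) (begin
        T′ * 2 + (D * 2 + 3 + suc (suc D) * N)   ≡⟨ +-assoc (T′ * 2) (D * 2 + 3) _ ⟨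
        T′ * 2 + (D * 2 + 3) + suc (suc D) * N   ≤⟨ +-mono-≤ (transmission-G′ x) (≤-trans ends (+-monoˡ-≤ (suc D * 2) (proj₂ (proj₂ larger)))) ⟩
        (D + 3) * N + (M * 2 + suc D * 2)        ≡⟨ solve 3 (λ D L M → (D :+ con 3) :* (con 2 :+ D :+ L) :+ (M :* con 2 :+ (con 1 :+ D) :* con 2)
                                                       := M :* con 2 :+ (con 1 :+ (D :+ L)) :+ (D :* con 2 :+ con 3 :+ (con 2 :+ D) :* (con 2 :+ D :+ L))) refl D L M ⟩
        M * 2 + suc (D + L) + (D * 2 + 3 + suc (suc D) * N) ∎)
        where open ≤-Reasoning

balanced-caterpillar : ∀ {n} D L → suc (suc D) + L ≡ n → 1 ≤ D → ∀ ρ Ta Tb →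
  normalize n Ta ℚ.≤ ρ → normalize n Tb ℚ.≤ ρ → 0ℚ ℚ.≤ ρ → suc (suc D) * n ≤ Ta + Tb + suc D * 2 →
  Σ (Graph n) (λ G′ → IsCaterpillar G′ × diam G′ ≡ suc D × remoteness G′ ℚ.≤ ρ ℚ.+ ½)
balanced-caterpillar D L refl 1≤D ρ Ta Tb πa≤ρ πb≤ρ 0≤ρ ends =
  G′ , isCaterpillar-G′ , diam-G′ , remoteness-G′ ρ Ta Tb πa≤ρ πb≤ρ 0≤ρ ends
  where open Balanced D L 1≤D

lemma14 : (n D : ℕ) (G : Graph n) → IsCaterpillar G → ¬ IsPathGraph G → diam G ≡ D
    → (v : Fin (suc D) → Fin n) → DiametricPath G D v
    → (j : Fin (suc D)) → Centroidal G (v j) → (∀ u → Centroidal G u → u ≡ v j)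
    → (∀ (i : Fin (suc D)) → toℕ j < toℕ i → deg G (v i) ≤ 2)
    → Σ (Graph n) (λ G′ → IsCaterpillar G′ × diam G′ ≡ suc D × remoteness G′ ℚ.≤ remoteness G ℚ.+ ½)
lemma14 n D G ((connected , _) , spine-path) not-path diam≡D v _ _ _ _ _ =
  balanced-caterpillar D (n ∸ suc (suc D)) (m+[n∸m]≡n 2+D≤n) 1≤D (remoteness G) _ _
    (π≤remoteness G a) (π≤remoteness G b) (0≤remoteness G) ends-bound
  where
  caterpillar = IsCaterpillar⇒Caterpillar G connected not-path spine-path
  C = proj₁ caterpillar
  open Caterpillar C using (m)
  -- v zero only serves to show that G has a vertex, hence a nonempty spine
  E = caterpillar-ends C connected not-path (proj₂ caterpillar) (CaterpillarMetric.anchor C (v zero))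
  open Ends E using (a; b)
  open LongPath E using (3+m≤n; diam≡1+m; ends-transmission)
  3+m≤n′ = 3+m≤n not-path
  1+m≤n = ≤-trans (n≤1+n _) (≤-trans (n≤1+n _) 3+m≤n′)
  D≡1+m : D ≡ suc m
  D≡1+m = trans (sym diam≡D) (diam≡1+m 1+m≤n)
  1≤D : 1 ≤ D
  1≤D = subst (1 ≤_) (sym D≡1+m) (s≤s z≤n)
  2+D≤n : suc (suc D) ≤ n
  2+D≤n = subst (λ d → suc (suc d) ≤ n) (sym D≡1+m) 3+m≤n′
  ends-bound : suc (suc D) * n ≤ transmission G a + transmission G b + suc D * 2
  ends-bound = subst (λ d → suc d * n ≤ transmission G a + transmission G b + d * 2) (cong suc (sym D≡1+m))
                     (ends-transmission 1+m≤n)
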